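{- Let $G$ be a plane triangulation and suppose that edges $vw$ and $xy$ form a bad pair, both seen by vertices $p$ and $q$. Suppose that $vw$ blocks some edge $ab$. Then $xy$ and $ab$ are consecutive, and $vw$ and $xy$ lie in a common triangle.
   Context: A (plane) triangulation is a simple planar graph with a fixed combinatorial plane embedding in which every face is bounded by a $3$-cycle. For an edge $vw$ with incident faces $(v,w,x)$ and $(w,v,y)$, the vertices $x,y$ see $vw$. An edge $ab$ seen by $s,t$ is blocked by $st$ if $st$ is an edge of $G$ (so flipping $ab$ to $st$ would create a parallel edge). Two edges are consecutive if they are incident to a common face. Two edges form a bad pair if they are seen by the same pair of vertices. A triangle is a $3$-cycle of $G$. -}

module Defs where

open import Data.Nat using (ℕ; zero; suc; _+_; _/_)
open import Data.Fin using (Fin; zero; suc)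
open import Data.Bool using (Bool; true; false; T; _∨_; if_then_else_)
open import Data.Product using (Σ; ∃; _×_; _,_)
open import Data.Sum using (_⊎_)
open import Relation.Nullary using (¬_)
open import Relation.Binary.PropositionalEquality using (_≡_; _≢_)
open import Relation.Binary.Construct.Closure.ReflexiveTransitive using (Star)

sumFin : (n : ℕ) → (Fin n → ℕ) → ℕ
sumFin zero    f = 0
sumFin (suc n) f = f zero + sumFin n (λ i → f (suc i))

anyFin : (n : ℕ) → (Fin n → Bool) → Bool
anyFin zero    f = false
anyFin (suc n) f = f zero ∨ anyFin n (λ i → f (suc i))

boolToℕ : Bool → ℕ
boolToℕ b = if b then 1 else 0

-- A combinatorial embedded triangulation on vertex set Fin n is given by its
-- set of (oriented, counter-clockwise) triangular faces: face u v w = true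
-- iff (u, v, w) is a face, listed in its cyclic orientation.
FaceRel : ℕ → Set
FaceRel n = Fin n → Fin n → Fin n → Bool

module _ {n : ℕ} (face : FaceRel n) where

  Face : Fin n → Fin n → Fin n → Set
  Face u v w = T (face u v w)

  Adj : Fin n → Fin n → Set
  Adj u v = ∃ λ w → Face u v w

  dartCount : ℕ
  dartCount = sumFin n (λ u → sumFin n (λ v → boolToℕ (anyFin n (λ w → face u v w))))

  edgeCount : ℕ
  edgeCount = dartCount / 2

  -- each face is counted once per cyclic rotation
  faceCount : ℕ
  faceCount = sumFin n (λ u → sumFin n (λ v → sumFin n (λ w → boolToℕ (face u v w)))) / 3

  SideOf : Fin n → Fin n → Fin n → Fin n → Fin n → Set
  SideOf t1 t2 t3 c d =
      (c ≡ t1 × d ≡ t2) ⊎ (c ≡ t2 × d ≡ t1)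
    ⊎ (c ≡ t2 × d ≡ t3) ⊎ (c ≡ t3 × d ≡ t2)
    ⊎ (c ≡ t3 × d ≡ t1) ⊎ (c ≡ t1 × d ≡ t3)

  SeenBy : Fin n → Fin n → Fin n → Fin n → Set
  SeenBy a b s t = (Face a b s × Face b a t) ⊎ (Face a b t × Face b a s)

  BlockedBy : Fin n → Fin n → Fin n → Fin n → Set
  BlockedBy a b s t = Adj a b × SeenBy a b s t × Adj s t

  Consecutive : Fin n → Fin n → Fin n → Fin n → Set
  Consecutive a b c d =
    Σ (Fin n) λ u → Σ (Fin n) λ v → Σ (Fin n) λ w →
      Face u v w × SideOf u v w a b × SideOf u v w c d

  SameEdge : Fin n → Fin n → Fin n → Fin n → Set
  SameEdge a b c d = (a ≡ c × b ≡ d) ⊎ (a ≡ d × b ≡ c)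

  BadPair : Fin n → Fin n → Fin n → Fin n → Fin n → Fin n → Set
  BadPair a b c d p q =
    Adj a b × Adj c d × ¬ SameEdge a b c d × SeenBy a b p q × SeenBy c d p q

  Triangle : Fin n → Fin n → Fin n → Set
  Triangle t1 t2 t3 = t1 ≢ t2 × t2 ≢ t3 × t3 ≢ t1 × Adj t1 t2 × Adj t2 t3 × Adj t3 t1

  CommonTriangle : Fin n → Fin n → Fin n → Fin n → Set
  CommonTriangle a b c d =
    Σ (Fin n) λ t1 → Σ (Fin n) λ t2 → Σ (Fin n) λ t3 →
      Triangle t1 t2 t3 × SideOf t1 t2 t3 a b × SideOf t1 t2 t3 c d

  record IsPlaneTriangulation : Set where
    field
      face-distinct : ∀ {u v w} → Face u v w → u ≢ v × v ≢ w × w ≢ u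
      face-rotate   : ∀ {u v w} → Face u v w → Face v w u
      -- each dart (u,v) lies in at most one face ...
      dart-unique   : ∀ {u v w w′} → Face u v w → Face u v w′ → w ≡ w′
      -- ... and each edge has a face on its other side (closed oriented surface)
      dart-opposite : ∀ {u v w} → Face u v w → ∃ λ y → Face v u y
      -- the link of every vertex is a single cycle (surface, no pinch points)
      link-cycle    : ∀ {v a b c d} → Face v a b → Face v c d → Star (Face v) a c
      connected     : ∀ u v → Star Adj u v
      -- Euler's formula V - E + F = 2 (genus 0, i.e. a plane embedding)
      euler         : n + faceCount ≡ 2 + edgeCount

-- Since vw blocks ab, the vertices a and b are common neighbours of v and w; choose
-- c ∈ {a, b} distinct from p and q.  The non-facial triangle vwc separates p from q,
-- so every common neighbour of p and q lies on it: x, y ∈ {v, w, c}, hence xy is vc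
-- or wc, which gives both conclusions.  (If {a, b} = {p, q}, the link of p is the
-- triangle v w q and no such xy exists.)
--
-- Separation comes from Euler's formula by a tree–cotree argument.  Let T be a BFS
-- tree rooted at v (it contains vw and vc), call the edges outside T ∪ {wc} crossing,
-- and follow faces from vwp through crossing edges.  Going around a vertex off the
-- triangle (by induction from the leaves of T) shows that none of its edges separates
-- the faces on its two sides, so a path p x q off the triangle would lead from vwp to
-- wvq.  But then no edge separates, every face is reached, and F ≤ 1 + #crossing;
-- with V = 1 + #T and E ≥ #T + #crossing + 1 this contradicts V + F = E + 2.

module Submission where

open import Defs
open import Level using (0ℓ) renaming (suc to lsuc)
open import Data.Nat using (ℕ; zero; suc; pred; _+_; _*_; _≤_; _<_; _≤′_; z≤n; s≤s; ≤′-refl; ≤′-step; _/_; _<?_; _⊔_)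
open import Data.Nat.Properties
open import Data.Nat.DivMod using (m*n/n≡m)
open import Data.Fin as Fin using (Fin; zero; suc)
import Data.Fin.Properties as Finₚ
open import Data.Bool using (Bool; true; false; T)
open import Data.Bool.Properties using (T?)
open import Data.Unit using (tt)
open import Data.Product using (Σ; ∃; ∃₂; _×_; _,_; proj₁; proj₂; swap; map)
open import Data.Product.Properties using (≡-dec)
open import Data.Sum using (_⊎_; inj₁; inj₂)
open import Data.Empty using (⊥; ⊥-elim)
open import Function using (_∘_; id)
open import Function.Bundles using (_⇔_; mk⇔; module Equivalence)
open import Relation.Nullary using (¬_; ¬?; Dec; yes; no; does; _×-dec_; _⊎-dec_)
open import Relation.Nullary.Decidable using (toSum)
open import Relation.Nullary.Negation using (¬¬-map)
open import Relation.Unary using (Decidable)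
open import Relation.Binary using (Setoid; DecidableEquality; tri<; tri≈; tri>)
open import Relation.Binary.PropositionalEquality using (_≡_; _≢_; refl; sym; trans; cong; cong₂; subst; module ≡-Reasoning)
open import Relation.Binary.Construct.Closure.ReflexiveTransitive using (Star; ε; _◅_)
open import Algebra.Properties.CommutativeSemigroup +-commutativeSemigroup using (interchange)

-- Counting over finite types

𝟙 : {P : Set} → Dec P → ℕ
𝟙 P? = boolToℕ (does P?)

𝟙-≤1 : ∀ {P : Set} (P? : Dec P) → 𝟙 P? ≤ 1
𝟙-≤1 (yes _) = ≤-refl
𝟙-≤1 (no _)  = z≤n

𝟙-yes : ∀ {P : Set} (P? : Dec P) → P → 𝟙 P? ≡ 1
𝟙-yes (yes _) _ = refl
𝟙-yes (no ¬p) p = ⊥-elim (¬p p)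

𝟙-witness : ∀ {P : Set} (P? : Dec P) → 0 < 𝟙 P? → P
𝟙-witness (yes p) _ = p

𝟙-mono : ∀ {P Q : Set} (P? : Dec P) (Q? : Dec Q) → (P → Q) → 𝟙 P? ≤ 𝟙 Q?
𝟙-mono (yes p) Q? f = ≤-reflexive (sym (𝟙-yes Q? (f p)))
𝟙-mono (no _)  Q? f = z≤n

𝟙-cong : ∀ {P Q : Set} (P? : Dec P) (Q? : Dec Q) → (P → Q) → (Q → P) → 𝟙 P? ≡ 𝟙 Q?
𝟙-cong P? Q? f g = ≤-antisym (𝟙-mono P? Q? f) (𝟙-mono Q? P? g)

𝟙-⊎ : ∀ {P Q : Set} (P? : Dec P) (Q? : Dec Q) → ¬ (P × Q) → 𝟙 (P? ⊎-dec Q?) ≡ 𝟙 P? + 𝟙 Q?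
𝟙-⊎ (yes p) (yes q) disjoint = ⊥-elim (disjoint (p , q))
𝟙-⊎ (yes _) (no _)  _        = refl
𝟙-⊎ (no _)  (yes _) _        = refl
𝟙-⊎ (no _)  (no _)  _        = refl

record IsAdditive {Y : Set} (S : (Y → ℕ) → ℕ) : Set where
  field
    S-cong : ∀ {f g : Y → ℕ} → (∀ y → f y ≡ g y) → S f ≡ S g
    S-+    : ∀ (f g : Y → ℕ) → S (λ y → f y + g y) ≡ S f + S g
    S-0    : S (λ _ → 0) ≡ 0

record Summation (X : Set) : Set₁ where
  field
    ∑          : (X → ℕ) → ℕ
    ∑-additive : IsAdditive ∑
    ∑-mono     : ∀ {f g : X → ℕ} → (∀ x → f x ≤ g x) → ∑ f ≤ ∑ g
    ∑-term     : ∀ (f : X → ℕ) x → f x ≤ ∑ f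
    ∑-support  : ∀ (f : X → ℕ) → 0 < ∑ f → ∃ λ x → 0 < f x
    ∑-≤1       : ∀ (f : X → ℕ) → (∀ x → f x ≤ 1) → (∀ x y → 0 < f x → 0 < f y → x ≡ y) → ∑ f ≤ 1
    ∑-comm     : ∀ {Y : Set} {S : (Y → ℕ) → ℕ} → IsAdditive S →
                 ∀ (f : X → Y → ℕ) → ∑ (λ x → S (f x)) ≡ S (λ y → ∑ (λ x → f x y))

  open IsAdditive ∑-additive public renaming (S-cong to ∑-cong; S-+ to ∑-+; S-0 to ∑-0)

∑-swap : ∀ {X Y : Set} (SX : Summation X) (SY : Summation Y) (f : X → Y → ℕ) →
  Summation.∑ SX (λ x → Summation.∑ SY (f x)) ≡ Summation.∑ SY (λ y → Summation.∑ SX (λ x → f x y))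
∑-swap SX SY = Summation.∑-comm SX (Summation.∑-additive SY)

sumFin-mono : ∀ n {f g : Fin n → ℕ} → (∀ i → f i ≤ g i) → sumFin n f ≤ sumFin n g
sumFin-mono zero    _   = z≤n
sumFin-mono (suc n) f≤g = +-mono-≤ (f≤g zero) (sumFin-mono n (λ i → f≤g (suc i)))

sumFin-cong : ∀ n {f g : Fin n → ℕ} → (∀ i → f i ≡ g i) → sumFin n f ≡ sumFin n g
sumFin-cong n f≡g = ≤-antisym (sumFin-mono n (λ i → ≤-reflexive (f≡g i))) (sumFin-mono n (λ i → ≤-reflexive (sym (f≡g i))))

sumFin-+ : ∀ n (f g : Fin n → ℕ) → sumFin n (λ i → f i + g i) ≡ sumFin n f + sumFin n g
sumFin-+ zero    f g = refl
sumFin-+ (suc n) f g = trans (cong (f zero + g zero +_) (sumFin-+ n (λ i → f (suc i)) (λ i → g (suc i))))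
                             (interchange (f zero) (g zero) _ _)

sumFin-0 : ∀ n → sumFin n (λ _ → 0) ≡ 0
sumFin-0 zero    = refl
sumFin-0 (suc n) = sumFin-0 n

sumFin-1 : ∀ n → sumFin n (λ _ → 1) ≡ n
sumFin-1 zero    = refl
sumFin-1 (suc n) = cong suc (sumFin-1 n)

sumFin-term : ∀ n (f : Fin n → ℕ) i → f i ≤ sumFin n f
sumFin-term (suc n) f zero    = m≤m+n (f zero) _
sumFin-term (suc n) f (suc i) = ≤-trans (sumFin-term n (λ j → f (suc j)) i) (m≤n+m _ (f zero))

sumFin-support : ∀ n (f : Fin n → ℕ) → 0 < sumFin n f → ∃ λ i → 0 < f i
sumFin-support (suc n) f pos with 0 <? f zero
... | yes 0<f₀ = zero , 0<f₀
... | no  0≮f₀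
  with sumFin-support n (λ i → f (suc i)) (subst (λ k → 0 < k + sumFin n (λ i → f (suc i))) (n≤0⇒n≡0 (≮⇒≥ 0≮f₀)) pos)
...   | i , 0<fᵢ = suc i , 0<fᵢ

sumFin-≤1 : ∀ n (f : Fin n → ℕ) → (∀ i → f i ≤ 1) → (∀ i j → 0 < f i → 0 < f j → i ≡ j) → sumFin n f ≤ 1
sumFin-≤1 zero    f _   _      = z≤n
sumFin-≤1 (suc n) f f≤1 unique with 0 <? f zero
... | no 0≮f₀ = subst (λ k → k + sumFin n (λ i → f (suc i)) ≤ 1) (sym (n≤0⇒n≡0 (≮⇒≥ 0≮f₀)))
                  (sumFin-≤1 n (λ i → f (suc i)) (λ i → f≤1 (suc i)) (λ i j p q → Finₚ.suc-injective (unique _ _ p q)))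
... | yes 0<f₀ = subst (λ k → f zero + k ≤ 1) (sym rest≡0) (subst (_≤ 1) (sym (+-identityʳ _)) (f≤1 zero))
  where
  rest≡0 : sumFin n (λ i → f (suc i)) ≡ 0
  rest≡0 = n≤0⇒n≡0 (≤-trans (sumFin-mono n (λ i → ≮⇒≥ (λ 0<fᵢ → Finₚ.0≢1+n (unique zero (suc i) 0<f₀ 0<fᵢ))))
                            (≤-reflexive (sumFin-0 n)))

sumFin-comm : ∀ n {Y : Set} {S : (Y → ℕ) → ℕ} → IsAdditive S →
  ∀ (f : Fin n → Y → ℕ) → sumFin n (λ i → S (f i)) ≡ S (λ y → sumFin n (λ i → f i y))
sumFin-comm zero    S-additive f = sym (IsAdditive.S-0 S-additive)
sumFin-comm (suc n) {S = S} S-additive f =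
  trans (cong (S (f zero) +_) (sumFin-comm n S-additive (λ i → f (suc i))))
        (sym (S-+ (f zero) (λ y → sumFin n (λ i → f (suc i) y))))
  where open IsAdditive S-additive

sumFin-summation : ∀ n → Summation (Fin n)
sumFin-summation n = record
  { ∑          = sumFin n
  ; ∑-additive = record { S-cong = sumFin-cong n ; S-+ = sumFin-+ n ; S-0 = sumFin-0 n }
  ; ∑-mono     = sumFin-mono n
  ; ∑-term     = sumFin-term n
  ; ∑-support  = sumFin-support n
  ; ∑-≤1       = sumFin-≤1 n
  ; ∑-comm     = sumFin-comm n
  }

×-summation : ∀ {X Y : Set} → Summation X → Summation Y → Summation (X × Y)
×-summation {X} {Y} SX SY = record
  { ∑          = ∑
  ; ∑-additive = record
    { S-cong = λ f≡g → X.∑-cong (λ x → Y.∑-cong (λ y → f≡g (x , y)))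
    ; S-+    = λ f g → trans (X.∑-cong (λ x → Y.∑-+ (λ y → f (x , y)) (λ y → g (x , y)))) (X.∑-+ _ _)
    ; S-0    = trans (X.∑-cong (λ _ → Y.∑-0)) X.∑-0
    }
  ; ∑-mono     = λ f≤g → X.∑-mono (λ x → Y.∑-mono (λ y → f≤g (x , y)))
  ; ∑-term     = λ f (x , y) → ≤-trans (Y.∑-term (λ y → f (x , y)) y) (X.∑-term (λ x → Y.∑ (λ y → f (x , y))) x)
  ; ∑-support  = support
  ; ∑-≤1       = ≤1
  ; ∑-comm     = λ S-additive f →
      trans (X.∑-cong (λ x → Y.∑-comm S-additive (λ y → f (x , y))))
            (X.∑-comm S-additive (λ x z → Y.∑ (λ y → f (x , y) z)))
  }
  where
  module X = Summation SX
  module Y = Summation SY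
  ∑ : (X × Y → ℕ) → ℕ
  ∑ f = X.∑ (λ x → Y.∑ (λ y → f (x , y)))
  support : ∀ (f : X × Y → ℕ) → 0 < ∑ f → ∃ λ xy → 0 < f xy
  support f pos with X.∑-support _ pos
  ... | x , posₓ with Y.∑-support _ posₓ
  ...   | y , posₓᵧ = (x , y) , posₓᵧ
  ≤1 : ∀ (f : X × Y → ℕ) → (∀ xy → f xy ≤ 1) → (∀ xy xy′ → 0 < f xy → 0 < f xy′ → xy ≡ xy′) → ∑ f ≤ 1
  ≤1 f f≤1 unique = X.∑-≤1 _ row≤1 row-unique
    where
    row≤1 : ∀ x → Y.∑ (λ y → f (x , y)) ≤ 1
    row≤1 x = Y.∑-≤1 _ (λ y → f≤1 (x , y)) (λ y y′ p p′ → cong proj₂ (unique _ _ p p′))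
    row-unique : ∀ x x′ → 0 < Y.∑ (λ y → f (x , y)) → 0 < Y.∑ (λ y → f (x′ , y)) → x ≡ x′
    row-unique x x′ p p′ with Y.∑-support _ p | Y.∑-support _ p′
    ... | y , q | y′ , q′ = cong proj₁ (unique _ _ q q′)

module Counting {X : Set} (S : Summation X) where
  open Summation S

  count : {P : X → Set} → Decidable P → ℕ
  count P? = ∑ (λ x → 𝟙 (P? x))

  module _ {P Q : X → Set} (P? : Decidable P) (Q? : Decidable Q) where

    count-mono : (∀ {x} → P x → Q x) → count P? ≤ count Q?
    count-mono P⊆Q = ∑-mono (λ x → 𝟙-mono (P? x) (Q? x) P⊆Q)

    count-cong : (∀ {x} → P x → Q x) → (∀ {x} → Q x → P x) → count P? ≡ count Q?
    count-cong P⊆Q Q⊆P = ∑-cong (λ x → 𝟙-cong (P? x) (Q? x) P⊆Q Q⊆P)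

    count-⊎ : (∀ {x} → P x → Q x → ⊥) → count (λ x → P? x ⊎-dec Q? x) ≡ count P? + count Q?
    count-⊎ disjoint = trans (∑-cong (λ x → 𝟙-⊎ (P? x) (Q? x) (λ (p , q) → disjoint p q))) (∑-+ _ _)

  module _ {P : X → Set} (P? : Decidable P) where

    count-≤1 : (∀ {x y} → P x → P y → x ≡ y) → count P? ≤ 1
    count-≤1 unique = ∑-≤1 _ (λ x → 𝟙-≤1 (P? x)) (λ x y p q → unique (𝟙-witness (P? x) p) (𝟙-witness (P? y) q))

    count-≥1 : ∀ {x} → P x → 1 ≤ count P?
    count-≥1 {x} p = ≤-trans (≤-reflexive (sym (𝟙-yes (P? x) p))) (∑-term _ x)

open Counting

-- Double counting along the graph of f.  Since f may use the proof of P x, the graph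
-- is built from the decision P? x rather than from P itself.
count-injection : ∀ {X Y : Set} (SX : Summation X) (SY : Summation Y) {P : X → Set} {Q : Y → Set}
  (P? : Decidable P) (Q? : Decidable Q) → DecidableEquality Y →
  (f : ∀ x → P x → Y) → (∀ x p → Q (f x p)) → (∀ x x′ p p′ → f x p ≡ f x′ p′ → x ≡ x′) →
  count SX P? ≤ count SY Q?
count-injection {X} {Y} SX SY {P} {Q} P? Q? _≟_ f f-into f-injective = begin
  X.∑ (λ x → 𝟙 (P? x))               ≤⟨ X.∑-mono (λ x → graph-total x (P? x)) ⟩
  X.∑ (λ x → Y.∑ (λ y → graph x y))   ≡⟨ ∑-swap SX SY graph ⟩
  Y.∑ (λ y → X.∑ (λ x → graph x y))   ≤⟨ Y.∑-mono fibre≤1 ⟩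
  Y.∑ (λ y → 𝟙 (Q? y))               ∎
  where
  open ≤-Reasoning
  module X = Summation SX
  module Y = Summation SY

  graphᵈ : ∀ x → Dec (P x) → Y → ℕ
  graphᵈ x (yes p) y = 𝟙 (f x p ≟ y)
  graphᵈ x (no _)  y = 0

  graph : X → Y → ℕ
  graph x = graphᵈ x (P? x)

  graph-total : ∀ x (d : Dec (P x)) → 𝟙 d ≤ Y.∑ (graphᵈ x d)
  graph-total x (yes p) = ≤-trans (≤-reflexive (sym (𝟙-yes (f x p ≟ f x p) refl))) (Y.∑-term _ (f x p))
  graph-total x (no _)  = z≤n

  graph-≤1 : ∀ x (d : Dec (P x)) y → graphᵈ x d y ≤ 1
  graph-≤1 x (yes p) y = 𝟙-≤1 (f x p ≟ y)
  graph-≤1 x (no _)  y = z≤n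

  graph-hit : ∀ x (d : Dec (P x)) y → 0 < graphᵈ x d y → Σ (P x) λ p → f x p ≡ y
  graph-hit x (yes p) y hit = p , 𝟙-witness (f x p ≟ y) hit

  fibre≤1 : ∀ y → X.∑ (λ x → graph x y) ≤ 𝟙 (Q? y)
  fibre≤1 y with Q? y
  ... | yes _ = X.∑-≤1 _ (λ x → graph-≤1 x (P? x) y) unique
    where
    unique : ∀ x x′ → 0 < graph x y → 0 < graph x′ y → x ≡ x′
    unique x x′ hit hit′ with graph-hit x (P? x) y hit | graph-hit x′ (P? x′) y hit′
    ... | p , fx≡y | p′ , fx′≡y = f-injective x x′ p p′ (trans fx≡y (sym fx′≡y))
  ... | no ¬q = ≤-trans (X.∑-mono miss) (≤-reflexive X.∑-0)
    where
    miss : ∀ x → graph x y ≤ 0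
    miss x = ≮⇒≥ (λ hit → let p , fx≡y = graph-hit x (P? x) y hit in ¬q (subst Q fx≡y (f-into x p)))

anyFin⇒∃ : ∀ m (f : Fin m → Bool) → T (anyFin m f) → ∃ λ i → T (f i)
anyFin⇒∃ (suc m) f any with f zero in eq
... | true  = zero , subst T (sym eq) _
... | false = let i , fi = anyFin⇒∃ m (λ i → f (suc i)) any in suc i , fi

∃⇒anyFin : ∀ m (f : Fin m → Bool) i → T (f i) → T (anyFin m f)
∃⇒anyFin (suc m) f zero    fi with f zero
... | true = _
∃⇒anyFin (suc m) f (suc i) fi with f zero
... | true  = _
... | false = ∃⇒anyFin m (λ j → f (suc j)) i fi

Pair Triple : ℕ → Set
Pair n   = Fin n × Fin n
Triple n = Fin n × Fin n × Fin n

Σ₁ : ∀ n → Summation (Fin n)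
Σ₁ = sumFin-summation

Σ₂ : ∀ n → Summation (Pair n)
Σ₂ n = ×-summation (Σ₁ n) (Σ₁ n)

Σ₃ : ∀ n → Summation (Triple n)
Σ₃ n = ×-summation (Σ₁ n) (Σ₂ n)

rotate₃ : ∀ {n} → Triple n → Triple n
rotate₃ (a , b , c) = b , c , a

module _ {n : ℕ} where

  count-swap : ∀ {P : Pair n → Set} (P? : Decidable P) → count (Σ₂ n) (λ e → P? (swap e)) ≡ count (Σ₂ n) P?
  count-swap P? = ∑-swap (Σ₁ n) (Σ₁ n) (λ a b → 𝟙 (P? (b , a)))

  count-rotate : ∀ {P : Triple n → Set} (P? : Decidable P) → count (Σ₃ n) (λ t → P? (rotate₃ t)) ≡ count (Σ₃ n) P?
  count-rotate P? = trans (∑-swap (Σ₁ n) (Σ₁ n) (λ a b → sumFin n (λ c → 𝟙 (P? (b , c , a)))))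
                          (Summation.∑-cong (Σ₁ n) (λ b → ∑-swap (Σ₁ n) (Σ₁ n) (λ a c → 𝟙 (P? (b , c , a)))))

  -- An unordered edge is counted through its representative with the smaller vertex first.
  Canonical : (Fin n → Fin n → Set) → Pair n → Set
  Canonical R (a , b) = R a b × a Fin.< b

  canonical? : ∀ {R : Fin n → Fin n → Set} → (∀ a b → Dec (R a b)) → Decidable (Canonical R)
  canonical? R? (a , b) = R? a b ×-dec a Finₚ.<? b

  count-symmetric : ∀ {R : Fin n → Fin n → Set} (R? : ∀ a b → Dec (R a b)) →
    (∀ {a b} → R a b → R b a) → (∀ {a b} → R a b → a ≢ b) →
    count (Σ₂ n) (λ e → R? (proj₁ e) (proj₂ e)) ≡ 2 * count (Σ₂ n) (canonical? R?)
  count-symmetric {R} R? R-sym R-irrefl = begin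
    count (Σ₂ n) R?₂                                 ≡⟨ count-cong (Σ₂ n) R?₂ (λ e → C? e ⊎-dec C? (swap e)) split join ⟩
    count (Σ₂ n) (λ e → C? e ⊎-dec C? (swap e))       ≡⟨ count-⊎ (Σ₂ n) C? (λ e → C? (swap e)) opposite ⟩
    k + count (Σ₂ n) (λ e → C? (swap e))              ≡⟨ cong (k +_) (count-swap C?) ⟩
    k + k                                            ≡⟨ cong (k +_) (sym (+-identityʳ k)) ⟩
    2 * k                                            ∎
    where
    open ≡-Reasoning
    R?₂ : Decidable (λ (e : Pair n) → R (proj₁ e) (proj₂ e))
    R?₂ (a , b) = R? a b
    C? : Decidable (Canonical R)
    C? = canonical? R?
    k : ℕ
    k = count (Σ₂ n) C?
    opposite : ∀ {e} → Canonical R e → Canonical R (swap e) → ⊥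
    opposite (_ , a<b) (_ , b<a) = Finₚ.<-asym a<b b<a
    split : ∀ {e} → R (proj₁ e) (proj₂ e) → Canonical R e ⊎ Canonical R (swap e)
    split {a , b} r with Finₚ.<-cmp a b
    ... | tri< a<b _ _ = inj₁ (r , a<b)
    ... | tri≈ _ a≡b _ = ⊥-elim (R-irrefl r a≡b)
    ... | tri> _ _ b<a = inj₂ (R-sym r , b<a)
    join : ∀ {e} → Canonical R e ⊎ Canonical R (swap e) → R (proj₁ e) (proj₂ e)
    join (inj₁ (r , _)) = r
    join (inj₂ (r , _)) = R-sym r

  minimum-rotation : ∀ {a b c : Fin n} → a ≢ b → b ≢ c → c ≢ a →
    (a Fin.< b × a Fin.< c) ⊎ (b Fin.< c × b Fin.< a) ⊎ (c Fin.< a × c Fin.< b)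
  minimum-rotation {a} {b} {c} a≢b b≢c c≢a with Finₚ.<-cmp a b | Finₚ.<-cmp b c | Finₚ.<-cmp c a
  ... | tri≈ _ a≡b _ | _              | _              = ⊥-elim (a≢b a≡b)
  ... | _              | tri≈ _ b≡c _ | _              = ⊥-elim (b≢c b≡c)
  ... | _              | _              | tri≈ _ c≡a _ = ⊥-elim (c≢a c≡a)
  ... | tri< a<b _ _   | _              | tri> _ _ a<c   = inj₁ (a<b , a<c)
  ... | tri> _ _ b<a   | tri< b<c _ _   | _              = inj₂ (inj₁ (b<c , b<a))
  ... | _              | tri> _ _ c<b   | tri< c<a _ _   = inj₂ (inj₂ (c<a , c<b))
  ... | tri< a<b _ _   | tri< b<c _ _   | tri< c<a _ _   = ⊥-elim (Finₚ.<-asym a<b (Finₚ.<-trans b<c c<a))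
  ... | tri> _ _ b<a   | tri> _ _ c<b   | tri> _ _ a<c   = ⊥-elim (Finₚ.<-asym b<a (Finₚ.<-trans a<c c<b))

  sorted : ∀ {a b : Fin n} → Dec (a Fin.< b) → Pair n
  sorted {a} {b} (yes _) = a , b
  sorted {a} {b} (no _)  = b , a

  unordered : Fin n → Fin n → Pair n
  unordered a b = sorted (a Finₚ.<? b)

  unordered-canonical : ∀ {R : Fin n → Fin n → Set} → (∀ {a b} → R a b → R b a) →
    ∀ {a b} → a ≢ b → R a b → Canonical R (unordered a b)
  unordered-canonical R-sym {a} {b} a≢b r with a Finₚ.<? b
  ... | yes a<b = r , a<b
  ... | no  a≮b = R-sym r , Finₚ.≤∧≢⇒< (≮⇒≥ a≮b) (λ b≡a → a≢b (sym b≡a))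

  unordered-injective : ∀ {a b c d} → unordered a b ≡ unordered c d → (a ≡ c × b ≡ d) ⊎ (a ≡ d × b ≡ c)
  unordered-injective {a} {b} {c} {d} eq with a Finₚ.<? b | c Finₚ.<? d | eq
  ... | yes _ | yes _ | refl = inj₁ (refl , refl)
  ... | yes _ | no  _ | refl = inj₂ (refl , refl)
  ... | no  _ | yes _ | refl = inj₂ (refl , refl)
  ... | no  _ | no  _ | refl = inj₁ (refl , refl)

Among : ∀ {n} → Fin n → Fin n → Fin n → Fin n → Set
Among a b c x = x ≡ a ⊎ x ≡ b ⊎ x ≡ c

DartOf : ∀ {n} → Fin n → Fin n → Fin n → Fin n → Fin n → Set
DartOf a b c d₁ d₂ = (d₁ ≡ a × d₂ ≡ b) ⊎ (d₁ ≡ b × d₂ ≡ c) ⊎ (d₁ ≡ c × d₂ ≡ a)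

dartOf? : ∀ {n} (a b c d₁ d₂ : Fin n) → Dec (DartOf a b c d₁ d₂)
dartOf? a b c d₁ d₂ =
  (d₁ Finₚ.≟ a ×-dec d₂ Finₚ.≟ b) ⊎-dec (d₁ Finₚ.≟ b ×-dec d₂ Finₚ.≟ c) ⊎-dec (d₁ Finₚ.≟ c ×-dec d₂ Finₚ.≟ a)

dartOf-rotate : ∀ {n} {a b c d₁ d₂ : Fin n} → DartOf a b c d₁ d₂ → DartOf b c a d₁ d₂
dartOf-rotate (inj₁ d)        = inj₂ (inj₂ d)
dartOf-rotate (inj₂ (inj₁ d)) = inj₁ d
dartOf-rotate (inj₂ (inj₂ d)) = inj₂ (inj₁ d)

/-cancel : ∀ k m → suc m * k / suc m ≡ k
/-cancel k m = trans (cong (_/ suc m) (*-comm (suc m) k)) (m*n/n≡m k (suc m))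

-- Plane triangulations

module Triangulation {n : ℕ} (face : FaceRel n) (tri : IsPlaneTriangulation face) where
  open IsPlaneTriangulation tri public

  face? : ∀ a b c → Dec (Face face a b c)
  face? a b c = T? (face a b c)

  adj? : ∀ a b → Dec (Adj face a b)
  adj? a b = Finₚ.any? (face? a b)

  adj-sym : ∀ {a b} → Adj face a b → Adj face b a
  adj-sym (_ , f) = dart-opposite f

  adj-irrefl : ∀ {a b} → Adj face a b → a ≢ b
  adj-irrefl (_ , f) = proj₁ (face-distinct f)

  FaceTriple : Triple n → Set
  FaceTriple (a , b , c) = Face face a b c

  -- A face is counted through its rotation starting at its least vertex.
  CanonicalFace : Triple n → Set
  CanonicalFace (a , b , c) = Face face a b c × a Fin.< b × a Fin.< c

  canonicalFace? : Decidable CanonicalFace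
  canonicalFace? (a , b , c) = face? a b c ×-dec a Finₚ.<? b ×-dec a Finₚ.<? c

  edgeCount-canonical : edgeCount face ≡ count (Σ₂ n) (canonical? adj?)
  edgeCount-canonical = begin
    dartCount face / 2                                   ≡⟨ cong (_/ 2) (Summation.∑-cong (Σ₂ n) adjacency) ⟩
    count (Σ₂ n) (λ (a , b) → adj? a b) / 2              ≡⟨ cong (_/ 2) (count-symmetric adj? adj-sym adj-irrefl) ⟩
    2 * count (Σ₂ n) (canonical? adj?) / 2               ≡⟨ /-cancel _ 1 ⟩
    count (Σ₂ n) (canonical? adj?)                       ∎
    where
    open ≡-Reasoning
    adjacency : ∀ ((a , b) : Pair n) → boolToℕ (anyFin n (face a b)) ≡ 𝟙 (adj? a b)
    adjacency (a , b) = 𝟙-cong (T? (anyFin n (face a b))) (adj? a b) (anyFin⇒∃ n (face a b)) (λ (c , f) → ∃⇒anyFin n (face a b) c f)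

  faceCount-canonical : faceCount face ≡ count (Σ₃ n) canonicalFace?
  faceCount-canonical = begin
    count (Σ₃ n) F? / 3                           ≡⟨ cong (_/ 3) (count-cong (Σ₃ n) F? R₀₁₂? split join) ⟩
    count (Σ₃ n) R₀₁₂? / 3                        ≡⟨ cong (_/ 3) (count-⊎ (Σ₃ n) C? R₁₂? disjoint₁) ⟩
    (k + count (Σ₃ n) R₁₂?) / 3                   ≡⟨ cong (λ m → (k + m) / 3) (count-⊎ (Σ₃ n) R₁? R₂? disjoint₂) ⟩
    (k + (count (Σ₃ n) R₁? + count (Σ₃ n) R₂?)) / 3
                                                  ≡⟨ cong₂ (λ m m′ → (k + (m + m′)) / 3) (count-rotate C?) rotate²-invariant ⟩
    (k + (k + k)) / 3                             ≡⟨ cong (λ m → (k + (k + m)) / 3) (sym (+-identityʳ k)) ⟩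
    3 * k / 3                                     ≡⟨ /-cancel k 2 ⟩
    k                                             ∎
    where
    open ≡-Reasoning
    F? : Decidable FaceTriple
    F? (a , b , c) = face? a b c
    C? : Decidable CanonicalFace
    C? = canonicalFace?
    R₁? : Decidable (λ t → CanonicalFace (rotate₃ t))
    R₁? t = C? (rotate₃ t)
    R₂? : Decidable (λ t → CanonicalFace (rotate₃ (rotate₃ t)))
    R₂? t = C? (rotate₃ (rotate₃ t))
    R₁₂? : Decidable (λ t → CanonicalFace (rotate₃ t) ⊎ CanonicalFace (rotate₃ (rotate₃ t)))
    R₁₂? t = R₁? t ⊎-dec R₂? t
    R₀₁₂? : Decidable (λ t → CanonicalFace t ⊎ CanonicalFace (rotate₃ t) ⊎ CanonicalFace (rotate₃ (rotate₃ t)))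
    R₀₁₂? t = C? t ⊎-dec R₁₂? t
    k : ℕ
    k = count (Σ₃ n) C?
    rotate²-invariant : count (Σ₃ n) R₂? ≡ k
    rotate²-invariant = trans (count-rotate (λ t → C? (rotate₃ t))) (count-rotate C?)
    split : ∀ {t} → FaceTriple t → CanonicalFace t ⊎ CanonicalFace (rotate₃ t) ⊎ CanonicalFace (rotate₃ (rotate₃ t))
    split f with face-distinct f
    ... | a≢b , b≢c , c≢a with minimum-rotation a≢b b≢c c≢a
    ...   | inj₁ (a<b , a<c)         = inj₁ (f , a<b , a<c)
    ...   | inj₂ (inj₁ (b<c , b<a)) = inj₂ (inj₁ (face-rotate f , b<c , b<a))
    ...   | inj₂ (inj₂ (c<a , c<b)) = inj₂ (inj₂ (face-rotate (face-rotate f) , c<a , c<b))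
    join : ∀ {t} → CanonicalFace t ⊎ CanonicalFace (rotate₃ t) ⊎ CanonicalFace (rotate₃ (rotate₃ t)) → FaceTriple t
    join (inj₁ (f , _))         = f
    join (inj₂ (inj₁ (f , _))) = face-rotate (face-rotate f)
    join (inj₂ (inj₂ (f , _))) = face-rotate f
    disjoint₁ : ∀ {t} → CanonicalFace t → CanonicalFace (rotate₃ t) ⊎ CanonicalFace (rotate₃ (rotate₃ t)) → ⊥
    disjoint₁ (_ , a<b , _) (inj₁ (_ , _ , b<a)) = Finₚ.<-asym a<b b<a
    disjoint₁ (_ , _ , a<c) (inj₂ (_ , c<a , _)) = Finₚ.<-asym a<c c<a
    disjoint₂ : ∀ {t} → CanonicalFace (rotate₃ t) → CanonicalFace (rotate₃ (rotate₃ t)) → ⊥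
    disjoint₂ (_ , b<c , _) (_ , _ , c<b) = Finₚ.<-asym b<c c<b

  euler-canonical : n + count (Σ₃ n) canonicalFace? ≡ 2 + count (Σ₂ n) (canonical? adj?)
  euler-canonical = begin
    n + count (Σ₃ n) canonicalFace?    ≡⟨ cong (n +_) (sym faceCount-canonical) ⟩
    n + faceCount face                 ≡⟨ euler ⟩
    2 + edgeCount face                 ≡⟨ cong (2 +_) edgeCount-canonical ⟩
    2 + count (Σ₂ n) (canonical? adj?) ∎
    where open ≡-Reasoning

  canonicalFace-unique : ∀ {a b c a′ b′ c′ d₁ d₂} → CanonicalFace (a , b , c) → CanonicalFace (a′ , b′ , c′) →
    DartOf a b c d₁ d₂ → DartOf a′ b′ c′ d₁ d₂ → (a , b , c) ≡ (a′ , b′ , c′)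
  canonicalFace-unique (f , _) (f′ , _) (inj₁ (refl , refl)) (inj₁ (refl , refl))
    with refl ← dart-unique f f′ = refl
  canonicalFace-unique (f , _ , a<c) (f′ , a′<b′ , _) (inj₁ (refl , refl)) (inj₂ (inj₁ (refl , refl)))
    with refl ← dart-unique f (face-rotate f′) = ⊥-elim (Finₚ.<-asym a<c a′<b′)
  canonicalFace-unique (f , a<b , _) (f′ , _ , a′<c′) (inj₁ (refl , refl)) (inj₂ (inj₂ (refl , refl)))
    with refl ← dart-unique f (face-rotate (face-rotate f′)) = ⊥-elim (Finₚ.<-asym a<b a′<c′)
  canonicalFace-unique (f , a<b , _) (f′ , _ , a′<c′) (inj₂ (inj₁ (refl , refl))) (inj₁ (refl , refl))
    with refl ← dart-unique f′ (face-rotate f) = ⊥-elim (Finₚ.<-asym a<b a′<c′)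
  canonicalFace-unique (f , _) (f′ , _) (inj₂ (inj₁ (refl , refl))) (inj₂ (inj₁ (refl , refl)))
    with refl ← dart-unique (face-rotate f) (face-rotate f′) = refl
  canonicalFace-unique (f , _ , a<c) (f′ , a′<b′ , _) (inj₂ (inj₁ (refl , refl))) (inj₂ (inj₂ (refl , refl)))
    with refl ← dart-unique (face-rotate f) (face-rotate (face-rotate f′)) = ⊥-elim (Finₚ.<-asym a<c a′<b′)
  canonicalFace-unique (f , _ , a<c) (f′ , a′<b′ , _) (inj₂ (inj₂ (refl , refl))) (inj₁ (refl , refl))
    with refl ← dart-unique f′ (face-rotate (face-rotate f)) = ⊥-elim (Finₚ.<-asym a<c a′<b′)
  canonicalFace-unique (f , a<b , _) (f′ , _ , a′<c′) (inj₂ (inj₂ (refl , refl))) (inj₂ (inj₁ (refl , refl)))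
    with refl ← dart-unique (face-rotate f′) (face-rotate (face-rotate f)) = ⊥-elim (Finₚ.<-asym a<b a′<c′)
  canonicalFace-unique (f , _) (f′ , _) (inj₂ (inj₂ (refl , refl))) (inj₂ (inj₂ (refl , refl)))
    with refl ← dart-unique (face-rotate (face-rotate f)) (face-rotate (face-rotate f′)) = refl

  link-closed : ∀ {u a b c s t} → Face face u a b → Face face u b c → Face face u c a →
    Face face u s t → Among a b c s × Among a b c t
  link-closed {u} {a} {b} {c} {s} fab fbc fca fst = s∈ , successor s∈ fst
    where
    successor : ∀ {x y} → Among a b c x → Face face u x y → Among a b c y
    successor (inj₁ refl)        f = inj₂ (inj₁ (dart-unique f fab))
    successor (inj₂ (inj₁ refl)) f = inj₂ (inj₂ (dart-unique f fbc))
    successor (inj₂ (inj₂ refl)) f = inj₁ (dart-unique f fca)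
    along : ∀ {x y} → Among a b c x → Star (Face face u) x y → Among a b c y
    along x∈ ε        = x∈
    along x∈ (f ◅ fs) = along (successor x∈ f) fs
    s∈ : Among a b c s
    s∈ = along (inj₁ refl) (link-cycle fab fst)

  dartOf-same-face : ∀ {a b c r₁ r₂ r₃} → Face face r₁ r₂ r₃ → Face face a b c →
    DartOf r₁ r₂ r₃ a b → DartOf a b c r₁ r₂
  dartOf-same-face root f (inj₁ (refl , refl)) = inj₁ (refl , refl)
  dartOf-same-face root f (inj₂ (inj₁ (refl , refl)))
    with refl ← dart-unique f (face-rotate root) = inj₂ (inj₂ (refl , refl))
  dartOf-same-face root f (inj₂ (inj₂ (refl , refl)))
    with refl ← dart-unique f (face-rotate (face-rotate root)) = inj₂ (inj₁ (refl , refl))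

-- Spanning trees

step-mono : ∀ {P : ℕ → Set} → (∀ {k} → P k → P (suc k)) → ∀ {k j} → k ≤ j → P k → P j
step-mono {P} step k≤j = go (≤⇒≤′ k≤j)
  where
  go : ∀ {k j} → k ≤′ j → P k → P j
  go ≤′-refl       p = p
  go (≤′-step k≤j) p = step (go k≤j p)

least-witness : ∀ {P : ℕ → Set} → (∀ k → Dec (P k)) → ∀ {K} → P K → ∃ λ k → P k × (∀ {j} → P j → k ≤ j)
least-witness P? {zero} p = 0 , p , λ _ → z≤n
least-witness P? {suc K} p with P? 0
... | yes p₀ = 0 , p₀ , λ _ → z≤n
... | no ¬p₀ with least-witness (λ k → P? (suc k)) p
...   | k , pₖ , least = suc k , pₖ , λ { {zero} p₀ → ⊥-elim (¬p₀ p₀) ; {suc j} pⱼ → s≤s (least pⱼ) }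

uniform-bound : ∀ {m} {P : ℕ → Fin m → Set} → (∀ {k j i} → k ≤ j → P k i → P j i) →
  (∀ i → ∃ λ k → P k i) → ∃ λ K → ∀ i → P K i
uniform-bound {zero}  mono bounds = 0 , λ ()
uniform-bound {suc m} mono bounds with bounds zero | uniform-bound mono (λ i → bounds (suc i))
... | k₀ , p₀ | K , pₖ = k₀ ⊔ K , λ { zero → mono (m≤m⊔n k₀ K) p₀ ; (suc i) → mono (m≤n⊔m k₀ K) (pₖ i) }

¬¬-∀-Fin : ∀ {m} {P : Fin m → Set} → (∀ i → ¬ ¬ P i) → ¬ ¬ (∀ i → P i)
¬¬-∀-Fin {zero}  ¬¬P ¬∀ = ¬∀ λ ()
¬¬-∀-Fin {suc m} ¬¬P ¬∀ =
  ¬¬P zero λ p₀ → ¬¬-∀-Fin (λ i → ¬¬P (suc i)) λ ∀P → ¬∀ λ { zero → p₀ ; (suc i) → ∀P i }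

record SpanningTree {n : ℕ} (E : Fin n → Fin n → Set) (r : Fin n) : Set where
  field
    parent        : Fin n → Fin n
    depth         : Fin n → ℕ
    height        : ℕ
    parent-edge   : ∀ {u} → u ≢ r → E u (parent u)
    parent-depth  : ∀ {u} → u ≢ r → depth (parent u) < depth u
    depth≤height  : ∀ u → depth u ≤ height
    breadth-first : ∀ {u} → u ≢ r → E u r → parent u ≡ r

  parent-acyclic : ∀ {u y} → u ≢ r → y ≢ r → parent u ≡ y → parent y ≡ u → ⊥
  parent-acyclic {u} {y} u≢r y≢r pu≡y py≡u =
    <-asym (subst (λ z → depth z < depth u) pu≡y (parent-depth u≢r)) (subst (λ z → depth z < depth y) py≡u (parent-depth y≢r))

  leaf-induction : ∀ (P : Fin n → Set) → (∀ u → (∀ y → y ≢ r → parent y ≡ u → P y) → P u) → ∀ u → P u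
  leaf-induction P step u = go height u (m≤n+m height (depth u))
    where
    go : ∀ m u → height ≤ depth u + m → P u
    go m u bound = step u (λ y y≢r py≡u → below m (subst (λ z → depth z < depth y) py≡u (parent-depth y≢r)) bound)
      where
      below : ∀ m {y} → depth u < depth y → height ≤ depth u + m → P y
      below zero    {y} u<y bound = ⊥-elim (<⇒≱ u<y (≤-trans (depth≤height y) (≤-trans bound (≤-reflexive (+-identityʳ _)))))
      below (suc m) {y} u<y bound = go m y (≤-trans bound (≤-trans (≤-reflexive (+-suc (depth u) m)) (+-monoˡ-≤ m u<y)))

  TreeEdge : Fin n → Fin n → Set
  TreeEdge a b = (a ≢ r × parent a ≡ b) ⊎ (b ≢ r × parent b ≡ a)

  treeEdge? : ∀ a b → Dec (TreeEdge a b)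
  treeEdge? a b = (¬? (a Finₚ.≟ r) ×-dec parent a Finₚ.≟ b) ⊎-dec (¬? (b Finₚ.≟ r) ×-dec parent b Finₚ.≟ a)

  treeEdge-sym : ∀ {a b} → TreeEdge a b → TreeEdge b a
  treeEdge-sym (inj₁ e) = inj₂ e
  treeEdge-sym (inj₂ e) = inj₁ e

  parent≢ : ∀ {u} → u ≢ r → u ≢ parent u
  parent≢ u≢r u≡pu = <-irrefl (cong depth (sym u≡pu)) (parent-depth u≢r)

  vertex-count : n ≤ 1 + count (Σ₂ n) (canonical? treeEdge?)
  vertex-count = begin
    n                                                ≡⟨ sym (sumFin-1 n) ⟩
    count (Σ₁ n) (λ _ → yes tt)                      ≡⟨ root-or-not ⟩
    count (Σ₁ n) root? + count (Σ₁ n) non-root?      ≤⟨ +-mono-≤ root-once parent-edges ⟩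
    1 + count (Σ₂ n) (canonical? treeEdge?)          ∎
    where
    open ≤-Reasoning
    root? : Decidable (_≡ r)
    root? u = u Finₚ.≟ r
    non-root? : Decidable (_≢ r)
    non-root? u = ¬? (u Finₚ.≟ r)
    root-or-not : count (Σ₁ n) (λ _ → yes tt) ≡ count (Σ₁ n) root? + count (Σ₁ n) non-root?
    root-or-not = trans (count-cong (Σ₁ n) (λ _ → yes tt) (λ u → root? u ⊎-dec non-root? u) (λ {u} _ → toSum (root? u)) (λ _ → tt))
                        (count-⊎ (Σ₁ n) root? non-root? (λ u≡r u≢r → u≢r u≡r))
    root-once : count (Σ₁ n) root? ≤ 1
    root-once = count-≤1 (Σ₁ n) root? (λ u≡r u′≡r → trans u≡r (sym u′≡r))
    parent-pair : ∀ u → u ≢ r → Pair n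
    parent-pair u _ = unordered u (parent u)
    parent-pair-tree : ∀ u u≢r → Canonical TreeEdge (parent-pair u u≢r)
    parent-pair-tree u u≢r = unordered-canonical {R = TreeEdge} treeEdge-sym {u} {parent u} (parent≢ u≢r) (inj₁ (u≢r , refl))
    parent-pair-injective : ∀ u u′ u≢r u′≢r → parent-pair u u≢r ≡ parent-pair u′ u′≢r → u ≡ u′
    parent-pair-injective u u′ u≢r u′≢r eq with unordered-injective eq
    ... | inj₁ (u≡u′ , _)       = u≡u′
    ... | inj₂ (u≡pu′ , pu≡u′) = ⊥-elim (parent-acyclic u≢r u′≢r pu≡u′ (sym u≡pu′))
    parent-edges : count (Σ₁ n) non-root? ≤ count (Σ₂ n) (canonical? treeEdge?)
    parent-edges = count-injection (Σ₁ n) (Σ₂ n) non-root? (canonical? treeEdge?) (≡-dec Finₚ._≟_ Finₚ._≟_)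
                     parent-pair parent-pair-tree parent-pair-injective

module _ {n : ℕ} {E : Fin n → Fin n → Set} (E? : ∀ u v → Dec (E u v)) (connected : ∀ u v → Star E u v) (r : Fin n) where

  private
    Within : ℕ → Fin n → Set
    Within zero    u = u ≡ r
    Within (suc k) u = Within k u ⊎ ∃ λ y → E u y × Within k y

    within? : ∀ k u → Dec (Within k u)
    within? zero    u = u Finₚ.≟ r
    within? (suc k) u = within? k u ⊎-dec Finₚ.any? (λ y → E? u y ×-dec within? k y)

    within-mono : ∀ {u k j} → k ≤ j → Within k u → Within j u
    within-mono = step-mono inj₁

    path-within : ∀ {u} → Star E u r → ∃ λ k → Within k u
    path-within ε        = 0 , refl
    path-within (e ◅ es) = let k , w = path-within es in suc k , inj₂ (_ , e , w)

    height : ℕ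
    height = proj₁ (uniform-bound within-mono (λ u → path-within (connected u r)))

    within-height : ∀ u → Within height u
    within-height = proj₂ (uniform-bound within-mono (λ u → path-within (connected u r)))

    depth : Fin n → ℕ
    depth u = proj₁ (least-witness (λ k → within? k u) (within-height u))

    within-depth : ∀ u → Within (depth u) u
    within-depth u = proj₁ (proj₂ (least-witness (λ k → within? k u) (within-height u)))

    depth-least : ∀ {u k} → Within k u → depth u ≤ k
    depth-least {u} = proj₂ (proj₂ (least-witness (λ k → within? k u) (within-height u)))

    Candidate : Fin n → Fin n → Set
    Candidate u y = E u y × Within (pred (depth u)) y

    candidate-exists : ∀ {u} → u ≢ r → ∃ (Candidate u)
    candidate-exists {u} u≢r with depth u in eq | within-depth u
    ... | zero  | u≡r = ⊥-elim (u≢r u≡r)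
    ... | suc j | inj₁ wⱼ = ⊥-elim (<-irrefl refl (subst (_≤ j) eq (depth-least wⱼ)))
    ... | suc j | inj₂ c  = c

    candidate? : ∀ u y → Dec (Candidate u y)
    candidate? u y = E? u y ×-dec within? (pred (depth u)) y

    choose : ∀ {P : Fin n → Set} → Fin n → Dec (∃ P) → Fin n
    choose _ (yes (y , _)) = y
    choose d (no _)        = d

    choose-spec : ∀ {P : Fin n → Set} d (P? : Dec (∃ P)) → ∃ P → P (choose d P?)
    choose-spec d (yes (_ , p)) _  = p
    choose-spec d (no ¬∃)       ∃P = ⊥-elim (¬∃ ∃P)

    parent : Fin n → Fin n
    parent u = choose r (Finₚ.any? (candidate? u))

    parent-candidate : ∀ {u} → u ≢ r → Candidate u (parent u)
    parent-candidate {u} u≢r = choose-spec r (Finₚ.any? (candidate? u)) (candidate-exists u≢r)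

    pred< : ∀ {k} → k ≢ 0 → pred k < k
    pred< {zero}  k≢0 = ⊥-elim (k≢0 refl)
    pred< {suc k} _   = ≤-refl

    depth≢0 : ∀ {u} → u ≢ r → depth u ≢ 0
    depth≢0 {u} u≢r depth≡0 = u≢r (subst (λ k → Within k u) depth≡0 (within-depth u))

    parent-depth : ∀ {u} → u ≢ r → depth (parent u) < depth u
    parent-depth {u} u≢r = ≤-<-trans (depth-least (proj₂ (parent-candidate u≢r))) (pred< (depth≢0 u≢r))

    breadth-first : ∀ {u} → u ≢ r → E u r → parent u ≡ r
    breadth-first {u} u≢r e = subst (λ k → Within k (parent u)) depth≡0 (within-depth (parent u))
      where
      depth≡0 : depth (parent u) ≡ 0
      depth≡0 = n<1⇒n≡0 (<-≤-trans (parent-depth u≢r) (depth-least {u} {1} (inj₂ (r , e , refl))))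

  bfs-tree : SpanningTree E r
  bfs-tree = record
    { parent        = parent
    ; depth         = depth
    ; height        = height
    ; parent-edge   = λ u≢r → proj₁ (parent-candidate u≢r)
    ; parent-depth  = parent-depth
    ; depth≤height  = λ u → depth-least (within-height u)
    ; breadth-first = breadth-first
    }

-- Faces reachable through crossable edges

-- Reachability of a face is not decidable, so equivalences between reachability
-- statements are only available under double negation; every use ends in ⊥.
infix 4 _≋_

_≋_ : Set → Set → Set
X ≋ Y = ¬ ¬ (X ⇔ Y)

module _ {X Y : Set} where
  open Equivalence

  ≋-intro : (X → Y) → (Y → X) → X ≋ Y
  ≋-intro f g k = k (mk⇔ f g)

  ≋-sym : X ≋ Y → Y ≋ X
  ≋-sym = ¬¬-map (λ e → mk⇔ (from e) (to e))

  ≋-trans : ∀ {Z : Set} → X ≋ Y → Y ≋ Z → X ≋ Z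
  ≋-trans p q k = p λ e → q λ e′ → k (mk⇔ (to e′ ∘ to e) (from e ∘ from e′))

  ≋-¬¬ : X ≋ Y → ¬ ¬ X → ¬ ¬ Y
  ≋-¬¬ p ¬¬x ¬y = p λ e → ¬¬x (¬y ∘ to e)

≋-setoid : Setoid (lsuc 0ℓ) 0ℓ
≋-setoid = record
  { Carrier       = Set
  ; _≈_           = _≋_
  ; isEquivalence = record { refl = ≋-intro id id ; sym = ≋-sym ; trans = ≋-trans }
  }

module DualReachability {n : ℕ} (face : FaceRel n) (tri : IsPlaneTriangulation face)
  (Crossable : Fin n → Fin n → Set) (crossable? : ∀ a b → Dec (Crossable a b))
  (crossable-sym : ∀ {a b} → Crossable a b → Crossable b a)
  (crossable-adj : ∀ {a b} → Crossable a b → Adj face a b)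
  {r₁ r₂ r₃ : Fin n} (root : Face face r₁ r₂ r₃) where

  open Triangulation face tri

  -- Reach k a b: the face to the left of the dart ab is reached from the root face
  -- crossing at most k crossable edges.
  mutual
    Reach : ℕ → Fin n → Fin n → Set
    Reach zero    a b = DartOf r₁ r₂ r₃ a b
    Reach (suc k) a b = Reach k a b ⊎ ∃ λ c → Face face a b c × ∃₂ λ d₁ d₂ → DartOf a b c d₁ d₂ × Entered k d₁ d₂

    Entered : ℕ → Fin n → Fin n → Set
    Entered k d₁ d₂ = Crossable d₁ d₂ × Reach k d₂ d₁

  reach? : ∀ k a b → Dec (Reach k a b)
  reach? zero    a b = dartOf? r₁ r₂ r₃ a b
  reach? (suc k) a b = reach? k a b ⊎-dec Finₚ.any? λ c → face? a b c ×-dec Finₚ.any? λ d₁ → Finₚ.any? λ d₂ →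
    dartOf? a b c d₁ d₂ ×-dec (crossable? d₁ d₂ ×-dec reach? k d₂ d₁)

  reach-mono : ∀ {k j a b} → k ≤ j → Reach k a b → Reach j a b
  reach-mono = step-mono inj₁

  reach-rotate : ∀ {k a b c} → Face face a b c → Reach k a b → Reach k b c
  reach-rotate {zero} f (inj₁ (refl , refl))        = inj₂ (inj₁ (refl , dart-unique f root))
  reach-rotate {zero} f (inj₂ (inj₁ (refl , refl))) = inj₂ (inj₂ (refl , dart-unique f (face-rotate root)))
  reach-rotate {zero} f (inj₂ (inj₂ (refl , refl))) = inj₁ (refl , dart-unique f (face-rotate (face-rotate root)))
  reach-rotate {suc k} f (inj₁ r) = inj₁ (reach-rotate f r)
  reach-rotate {suc k} f (inj₂ (c , f′ , d₁ , d₂ , dart , entered)) with refl ← dart-unique f f′ =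
    inj₂ (_ , face-rotate f , d₁ , d₂ , dartOf-rotate dart , entered)

  reach-dartOf : ∀ {k a b c d₁ d₂} → Face face a b c → DartOf a b c d₁ d₂ → Reach k d₁ d₂ → Reach k a b
  reach-dartOf f (inj₁ (refl , refl))        r = r
  reach-dartOf f (inj₂ (inj₁ (refl , refl))) r = reach-rotate (face-rotate (face-rotate f)) (reach-rotate (face-rotate f) r)
  reach-dartOf f (inj₂ (inj₂ (refl , refl))) r = reach-rotate (face-rotate (face-rotate f)) r

  Reached : Fin n → Fin n → Set
  Reached a b = ∃ λ k → Reach k a b

  reached-rotate : ∀ {a b c} → Face face a b c → Reached a b → Reached b c
  reached-rotate f (k , r) = k , reach-rotate f r

  reached-cross : ∀ {a b} → Crossable a b → Reached b a → Reached a b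
  reached-cross {a} {b} x (k , r) = let c , f = crossable-adj x in
    suc k , inj₂ (c , f , a , b , inj₁ (refl , refl) , x , r)

  Separates : Fin n → Fin n → Set
  Separates a b = ¬ (Reached a b ⇔ Reached b a)

  ¬separates-sym : ∀ {a b} → ¬ Separates a b → ¬ Separates b a
  ¬separates-sym = ≋-sym

  ¬separates-crossable : ∀ {a b} → Crossable a b → ¬ Separates a b
  ¬separates-crossable x = ≋-intro (reached-cross (crossable-sym x)) (reached-cross x)

  reached-face : ∀ {a b c} → Face face a b c → Reached a b ≋ Reached c a
  reached-face f = ≋-intro (reached-rotate (face-rotate f) ∘ reached-rotate f) (reached-rotate (face-rotate (face-rotate f)))

  reached-face′ : ∀ {a b c} → Face face a b c → Reached a b ≋ Reached b c
  reached-face′ f = ≋-intro (reached-rotate f) (reached-rotate (face-rotate (face-rotate f)) ∘ reached-rotate (face-rotate f))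

  reached-around : ∀ {u y y′} → Face face u y y′ → ¬ Separates u y′ → Reached u y ≋ Reached u y′
  reached-around f ¬sep = ≋-trans (reached-face f) (≋-sym ¬sep)

  walk-link : ∀ {u s} → (∀ {y y′} → Face face u y y′ → y ≢ s → Reached u y ≋ Reached u y′) →
    ∀ {y} → Star (Face face u) y s → Reached u y ≋ Reached u s
  walk-link step ε = ≋-intro id id
  walk-link {s = s} step {y} (f ◅ fs) with y Finₚ.≟ s
  ... | yes refl = ≋-intro id id
  ... | no y≢s   = ≋-trans (step f y≢s) (walk-link step fs)

  link-reached : ∀ {u} → (∀ {y} → Adj face u y → ¬ Separates u y) →
    ∀ {y y′} → Adj face u y → Adj face u y′ → Reached u y ≋ Reached u y′
  link-reached all (_ , f) (_ , f′) =
    walk-link (λ g _ → reached-around g (all (adj-sym (_ , face-rotate (face-rotate g))))) (link-cycle f f′)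

  last-edge-¬separates : ∀ {u z} → Adj face u z → (∀ {y} → Adj face u y → y ≢ z → ¬ Separates u y) → ¬ Separates u z
  last-edge-¬separates {u} {z} (_ , f) others =
    ≋-trans (walk-link step (link-cycle f f-back)) (reached-face f-back)
    where
    s : Fin n
    s = proj₁ (dart-opposite f)
    f-back : Face face u s z
    f-back = face-rotate (proj₂ (dart-opposite f))
    step : ∀ {y y′} → Face face u y y′ → y ≢ s → Reached u y ≋ Reached u y′
    step g y≢s = reached-around g (others (adj-sym (_ , face-rotate (face-rotate g))) λ { refl →
      y≢s (dart-unique (face-rotate (face-rotate g)) (face-rotate (face-rotate f-back))) })

  reach-bound : (∀ {a b} → Adj face a b → ¬ ¬ Reached a b) → ¬ ¬ (∃ λ K → ∀ a b → Adj face a b → Reach K a b)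
  reach-bound all = ¬¬-map (uniform-bound (λ k≤j rₖ b ab → reach-mono k≤j (rₖ b ab)))
                      (¬¬-∀-Fin λ a → ¬¬-map (uniform-bound (λ k≤j rₖ ab → reach-mono k≤j (rₖ ab)))
                        (¬¬-∀-Fin (dart-bound a)))
    where
    dart-bound : ∀ a b → ¬ ¬ (∃ λ k → Adj face a b → Reach k a b)
    dart-bound a b with adj? a b
    ... | yes ab = ¬¬-map (λ (k , r) → k , λ _ → r) (all ab)
    ... | no ¬ab = λ k → k (0 , λ ab → ⊥-elim (¬ab ab))

  FirstEntry : Fin n → Fin n → Fin n → Set
  FirstEntry a b c = ∃ λ j → ¬ Reach j a b × ∃₂ λ d₁ d₂ → DartOf a b c d₁ d₂ × Entered j d₁ d₂

  first-entry : ∀ {a b c} k → Face face a b c → Reach k a b → ¬ Reach 0 a b → FirstEntry a b c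
  first-entry zero    f r ¬r₀ = ⊥-elim (¬r₀ r)
  first-entry {a} {b} (suc k) f r ¬r₀ with reach? k a b | r
  ... | yes rₖ | _       = first-entry k f rₖ ¬r₀
  ... | no ¬rₖ | inj₁ rₖ = ⊥-elim (¬rₖ rₖ)
  ... | no ¬rₖ | inj₂ (c , f′ , entry) with refl ← dart-unique f f′ = k , ¬rₖ , entry

  entry-edge : ∀ {a b c} → FirstEntry a b c → Pair n
  entry-edge (_ , _ , d₁ , d₂ , _) = unordered d₁ d₂

  entry-edge-crossable : ∀ {a b c} (e : FirstEntry a b c) → Canonical Crossable (entry-edge e)
  entry-edge-crossable (_ , _ , d₁ , d₂ , _ , x , _) =
    unordered-canonical {R = Crossable} crossable-sym {d₁} {d₂} (adj-irrefl (crossable-adj x)) x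

  entry-edge-injective : ∀ {a b c a′ b′ c′} → CanonicalFace (a , b , c) → CanonicalFace (a′ , b′ , c′) →
    (e : FirstEntry a b c) (e′ : FirstEntry a′ b′ c′) → entry-edge e ≡ entry-edge e′ → (a , b , c) ≡ (a′ , b′ , c′)
  entry-edge-injective t t′ (j , ¬rⱼ , d₁ , d₂ , dart , _ , rⱼ) (j′ , ¬r′ⱼ′ , d₁′ , d₂′ , dart′ , _ , r′ⱼ′) eq
    with unordered-injective eq
  ... | inj₁ (refl , refl) = canonicalFace-unique t t′ dart dart′
  ... | inj₂ (refl , refl) with ≤-total j j′
  ...   | inj₁ j≤j′ = ⊥-elim (¬r′ⱼ′ (reach-dartOf (proj₁ t′) dart′ (reach-mono j≤j′ rⱼ)))
  ...   | inj₂ j′≤j = ⊥-elim (¬rⱼ (reach-dartOf (proj₁ t) dart (reach-mono j′≤j r′ⱼ′)))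

  face-count : ∀ {K} → (∀ a b → Adj face a b → Reach K a b) →
    count (Σ₃ n) canonicalFace? ≤ 1 + count (Σ₂ n) (canonical? crossable?)
  face-count {K} reached = begin
    count (Σ₃ n) canonicalFace?                    ≡⟨ count-cong (Σ₃ n) canonicalFace? rooted-or-not split proj₁-⊎ ⟩
    count (Σ₃ n) rooted-or-not                     ≡⟨ count-⊎ (Σ₃ n) rooted? unrooted? (λ (_ , r₀) (_ , ¬r₀) → ¬r₀ r₀) ⟩
    count (Σ₃ n) rooted? + count (Σ₃ n) unrooted?  ≤⟨ +-mono-≤ (count-≤1 (Σ₃ n) rooted? rooted-unique) entry-edges ⟩
    1 + count (Σ₂ n) (canonical? crossable?)        ∎
    where
    open ≤-Reasoning
    Rooted Unrooted : Triple n → Set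
    Rooted   (a , b , c) = CanonicalFace (a , b , c) × Reach 0 a b
    Unrooted (a , b , c) = CanonicalFace (a , b , c) × ¬ Reach 0 a b
    rooted? : Decidable Rooted
    rooted? (a , b , c) = canonicalFace? (a , b , c) ×-dec reach? 0 a b
    unrooted? : Decidable Unrooted
    unrooted? (a , b , c) = canonicalFace? (a , b , c) ×-dec ¬? (reach? 0 a b)
    rooted-or-not : Decidable (λ t → Rooted t ⊎ Unrooted t)
    rooted-or-not t = rooted? t ⊎-dec unrooted? t
    split : ∀ {t} → CanonicalFace t → Rooted t ⊎ Unrooted t
    split {a , b , c} t with reach? 0 a b
    ... | yes r₀ = inj₁ (t , r₀)
    ... | no ¬r₀ = inj₂ (t , ¬r₀)
    proj₁-⊎ : ∀ {t} → Rooted t ⊎ Unrooted t → CanonicalFace t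
    proj₁-⊎ (inj₁ (t , _)) = t
    proj₁-⊎ (inj₂ (t , _)) = t
    rooted-unique : ∀ {t t′} → Rooted t → Rooted t′ → t ≡ t′
    rooted-unique (t , r₀) (t′ , r₀′) =
      canonicalFace-unique t t′ (dartOf-same-face root (proj₁ t) r₀) (dartOf-same-face root (proj₁ t′) r₀′)
    first-entry-of : ∀ {a b c} → Unrooted (a , b , c) → FirstEntry a b c
    first-entry-of {a} {b} {c} (t , ¬r₀) = first-entry K (proj₁ t) (reached a b (c , proj₁ t)) ¬r₀
    entry : ∀ t → Unrooted t → Pair n
    entry _ u = entry-edge (first-entry-of u)
    entry-crossable : ∀ t u → Canonical Crossable (entry t u)
    entry-crossable _ u = entry-edge-crossable (first-entry-of u)
    entry-injective : ∀ t t′ u u′ → entry t u ≡ entry t′ u′ → t ≡ t′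
    entry-injective _ _ u u′ = entry-edge-injective (proj₁ u) (proj₁ u′) (first-entry-of u) (first-entry-of u′)
    entry-edges : count (Σ₃ n) unrooted? ≤ count (Σ₂ n) (canonical? crossable?)
    entry-edges = count-injection (Σ₃ n) (Σ₂ n) unrooted? (canonical? crossable?) (≡-dec Finₚ._≟_ Finₚ._≟_)
                    entry entry-crossable entry-injective

-- The separating triangle

module SeparatingTriangle {n : ℕ} (face : FaceRel n) (tri : IsPlaneTriangulation face)
  {v w p q c : Fin n} (vwp : Face face v w p) (wvq : Face face w v q)
  (vc : Adj face v c) (wc : Adj face w c) (c≢p : c ≢ p) (c≢q : c ≢ q) where

  open Triangulation face tri
  open SpanningTree (bfs-tree adj? connected v)

  Closing : Fin n → Fin n → Set
  Closing a b = SameEdge face a b w c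

  closing? : ∀ a b → Dec (Closing a b)
  closing? a b = (a Finₚ.≟ w ×-dec b Finₚ.≟ c) ⊎-dec (a Finₚ.≟ c ×-dec b Finₚ.≟ w)

  closing-sym : ∀ {a b} → Closing a b → Closing b a
  closing-sym (inj₁ (a≡w , b≡c)) = inj₂ (b≡c , a≡w)
  closing-sym (inj₂ (a≡c , b≡w)) = inj₁ (b≡w , a≡c)

  Crossing : Fin n → Fin n → Set
  Crossing a b = Adj face a b × ¬ TreeEdge a b × ¬ Closing a b

  crossing? : ∀ a b → Dec (Crossing a b)
  crossing? a b = adj? a b ×-dec ¬? (treeEdge? a b) ×-dec ¬? (closing? a b)

  crossing-sym : ∀ {a b} → Crossing a b → Crossing b a
  crossing-sym (ab , ¬tree , ¬closing) = adj-sym ab , ¬tree ∘ treeEdge-sym , ¬closing ∘ closing-sym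

  open DualReachability face tri Crossing crossing? crossing-sym proj₁ vwp

  w≢v : w ≢ v
  w≢v = proj₁ (face-distinct wvq)

  c≢v : c ≢ v
  c≢v = adj-irrefl (adj-sym vc)

  parent-w : parent w ≡ v
  parent-w = breadth-first w≢v (adj-sym (p , vwp))

  parent-c : parent c ≡ v
  parent-c = breadth-first c≢v (adj-sym vc)

  OffTriangle : Fin n → Set
  OffTriangle u = ¬ Among v w c u

  among? : ∀ u → Dec (Among v w c u)
  among? u = u Finₚ.≟ v ⊎-dec u Finₚ.≟ w ⊎-dec u Finₚ.≟ c

  p-off : OffTriangle p
  p-off (inj₁ refl)        = proj₂ (proj₂ (face-distinct vwp)) refl
  p-off (inj₂ (inj₁ refl)) = proj₁ (proj₂ (face-distinct vwp)) refl
  p-off (inj₂ (inj₂ refl)) = c≢p refl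

  q-off : OffTriangle q
  q-off (inj₁ refl)        = proj₁ (proj₂ (face-distinct wvq)) refl
  q-off (inj₂ (inj₁ refl)) = proj₂ (proj₂ (face-distinct wvq)) refl
  q-off (inj₂ (inj₂ refl)) = c≢q refl

  closing-not-tree : ∀ {a b} → Closing a b → ¬ TreeEdge a b
  closing-not-tree (inj₁ (refl , refl)) (inj₁ (_ , pw≡c))   = c≢v (trans (sym pw≡c) parent-w)
  closing-not-tree (inj₁ (refl , refl)) (inj₂ (_ , pc≡w))   = w≢v (trans (sym pc≡w) parent-c)
  closing-not-tree (inj₂ (refl , refl)) (inj₁ (_ , pc≡w))   = w≢v (trans (sym pc≡w) parent-c)
  closing-not-tree (inj₂ (refl , refl)) (inj₂ (_ , pw≡c))   = c≢v (trans (sym pw≡c) parent-w)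

  edge-cases : ∀ {a b} → Adj face a b → TreeEdge a b ⊎ Closing a b ⊎ Crossing a b
  edge-cases {a} {b} ab with treeEdge? a b | closing? a b
  ... | yes tree | _           = inj₁ tree
  ... | no ¬tree | yes closing = inj₂ (inj₁ closing)
  ... | no ¬tree | no ¬closing = inj₂ (inj₂ (ab , ¬tree , ¬closing))

  closing-on-triangle : ∀ {a b} → Closing a b → Among v w c a
  closing-on-triangle (inj₁ (refl , _)) = inj₂ (inj₁ refl)
  closing-on-triangle (inj₂ (refl , _)) = inj₂ (inj₂ refl)

  child-off : ∀ {u y} → OffTriangle u → y ≢ v → parent y ≡ u → OffTriangle y
  child-off u-off y≢v _    (inj₁ y≡v)        = y≢v y≡v
  child-off u-off y≢v pw≡u (inj₂ (inj₁ refl)) = u-off (inj₁ (trans (sym pw≡u) parent-w))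
  child-off u-off y≢v pc≡u (inj₂ (inj₂ refl)) = u-off (inj₁ (trans (sym pc≡u) parent-c))

  parent-edge-¬separates : ∀ u → OffTriangle u → ¬ Separates u (parent u)
  parent-edge-¬separates = leaf-induction (λ u → OffTriangle u → ¬ Separates u (parent u)) step
    where
    step : ∀ u → (∀ y → y ≢ v → parent y ≡ u → OffTriangle y → ¬ Separates y (parent y)) →
      OffTriangle u → ¬ Separates u (parent u)
    step u children u-off = last-edge-¬separates (parent-edge (u-off ∘ inj₁)) other
      where
      other : ∀ {y} → Adj face u y → y ≢ parent u → ¬ Separates u y
      other uy y≢pu with edge-cases uy
      ... | inj₁ (inj₁ (_ , pu≡y))  = ⊥-elim (y≢pu (sym pu≡y))
      ... | inj₁ (inj₂ (y≢v , py≡u)) =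
        ¬separates-sym (subst (λ z → ¬ Separates _ z) py≡u (children _ y≢v py≡u (child-off u-off y≢v py≡u)))
      ... | inj₂ (inj₁ closing)      = ⊥-elim (u-off (closing-on-triangle closing))
      ... | inj₂ (inj₂ crossing)     = ¬separates-crossable crossing

  off-triangle-¬separates : ∀ {u y} → OffTriangle u → Adj face u y → ¬ Separates u y
  off-triangle-¬separates {u} u-off uy with edge-cases uy
  ... | inj₁ (inj₁ (_ , pu≡y))  = subst (λ z → ¬ Separates u z) pu≡y (parent-edge-¬separates u u-off)
  ... | inj₁ (inj₂ (y≢v , py≡u)) =
    ¬separates-sym (subst (λ z → ¬ Separates _ z) py≡u (parent-edge-¬separates _ (child-off u-off y≢v py≡u)))
  ... | inj₂ (inj₁ closing)      = ⊥-elim (u-off (closing-on-triangle closing))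
  ... | inj₂ (inj₂ crossing)     = ¬separates-crossable crossing

  common-neighbour-off-triangle⇒¬separates-vw : ∀ {x} → OffTriangle x → Adj face p x → Adj face x q → ¬ Separates v w
  common-neighbour-off-triangle⇒¬separates-vw {x} x-off px xq = chain
    where
    open import Relation.Binary.Reasoning.Setoid ≋-setoid
    around : ∀ {u} → OffTriangle u → ∀ {y y′} → Adj face u y → Adj face u y′ → Reached u y ≋ Reached u y′
    around u-off = link-reached (off-triangle-¬separates u-off)
    chain : Reached v w ≋ Reached w v
    chain = begin
      Reached v w ≈⟨ reached-face vwp ⟩
      Reached p v ≈⟨ around p-off (w , face-rotate (face-rotate vwp)) px ⟩
      Reached p x ≈⟨ off-triangle-¬separates p-off px ⟩
      Reached x p ≈⟨ around x-off (adj-sym px) xq ⟩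
      Reached x q ≈⟨ off-triangle-¬separates x-off xq ⟩
      Reached q x ≈⟨ around q-off (adj-sym xq) (v , face-rotate (face-rotate wvq)) ⟩
      Reached q w ≈⟨ reached-face′ (face-rotate (face-rotate wvq)) ⟩
      Reached w v ∎

  off-triangle : ∀ {u} → u ≢ v → u ≢ w → u ≢ c → OffTriangle u
  off-triangle u≢v _ _ (inj₁ u≡v)        = u≢v u≡v
  off-triangle _ u≢w _ (inj₂ (inj₁ u≡w)) = u≢w u≡w
  off-triangle _ _ u≢c (inj₂ (inj₂ u≡c)) = u≢c u≡c

  ¬separates-vw⇒vc : ¬ Separates v w → ¬ Separates v c
  ¬separates-vw⇒vc ¬sep = last-edge-¬separates vc other
    where
    other : ∀ {y} → Adj face v y → y ≢ c → ¬ Separates v y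
    other {y} vy y≢c with y Finₚ.≟ w
    ... | yes refl = ¬sep
    ... | no y≢w   = ¬separates-sym (off-triangle-¬separates (off-triangle (adj-irrefl (adj-sym vy)) y≢w y≢c) (adj-sym vy))

  ¬separates-vw⇒wc : ¬ Separates v w → ¬ Separates w c
  ¬separates-vw⇒wc ¬sep = last-edge-¬separates wc other
    where
    other : ∀ {y} → Adj face w y → y ≢ c → ¬ Separates w y
    other {y} wy y≢c with y Finₚ.≟ v
    ... | yes refl = ¬separates-sym ¬sep
    ... | no y≢v   = ¬separates-sym (off-triangle-¬separates (off-triangle y≢v (adj-irrefl (adj-sym wy)) y≢c) (adj-sym wy))

  ¬separates-vw⇒all-¬separates : ¬ Separates v w → ∀ {a b} → Adj face a b → ¬ Separates a b
  ¬separates-vw⇒all-¬separates ¬sep {a} {b} ab with among? a | among? b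
  ... | no a-off | _        = off-triangle-¬separates a-off ab
  ... | yes _    | no b-off = ¬separates-sym (off-triangle-¬separates b-off (adj-sym ab))
  ... | yes (inj₁ refl)        | yes (inj₁ refl)        = ⊥-elim (adj-irrefl ab refl)
  ... | yes (inj₁ refl)        | yes (inj₂ (inj₁ refl)) = ¬sep
  ... | yes (inj₁ refl)        | yes (inj₂ (inj₂ refl)) = ¬separates-vw⇒vc ¬sep
  ... | yes (inj₂ (inj₁ refl)) | yes (inj₁ refl)        = ¬separates-sym ¬sep
  ... | yes (inj₂ (inj₁ refl)) | yes (inj₂ (inj₁ refl)) = ⊥-elim (adj-irrefl ab refl)
  ... | yes (inj₂ (inj₁ refl)) | yes (inj₂ (inj₂ refl)) = ¬separates-vw⇒wc ¬sep
  ... | yes (inj₂ (inj₂ refl)) | yes (inj₁ refl)        = ¬separates-sym (¬separates-vw⇒vc ¬sep)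
  ... | yes (inj₂ (inj₂ refl)) | yes (inj₂ (inj₁ refl)) = ¬separates-sym (¬separates-vw⇒wc ¬sep)
  ... | yes (inj₂ (inj₂ refl)) | yes (inj₂ (inj₂ refl)) = ⊥-elim (adj-irrefl ab refl)

  ¬separates-vw⇒all-reached : ¬ Separates v w → ∀ {a b} → Adj face a b → ¬ ¬ Reached a b
  ¬separates-vw⇒all-reached ¬sep {a} = spread (around (p , vwp) (λ k → k (0 , inj₁ (refl , refl)))) (connected v a)
    where
    Good : Fin n → Set
    Good u = ∀ {y} → Adj face u y → ¬ ¬ Reached u y
    around : ∀ {u y} → Adj face u y → ¬ ¬ Reached u y → Good u
    around uy reached uy′ = ≋-¬¬ (link-reached (¬separates-vw⇒all-¬separates ¬sep) uy uy′) reached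
    spread : ∀ {u a} → Good u → Star (Adj face) u a → Good a
    spread good ε                = good
    spread good ((t , f) ◅ path) = spread (around (_ , face-rotate f) (¬¬-map (reached-rotate f) (good (t , f)))) path

  treeEdge-adj : ∀ {a b} → TreeEdge a b → Adj face a b
  treeEdge-adj (inj₁ (a≢v , pa≡b)) = subst (Adj face _) pa≡b (parent-edge a≢v)
  treeEdge-adj (inj₂ (b≢v , pb≡a)) = adj-sym (subst (Adj face _) pb≡a (parent-edge b≢v))

  closing-adj : ∀ {a b} → Closing a b → Adj face a b
  closing-adj (inj₁ (refl , refl)) = wc
  closing-adj (inj₂ (refl , refl)) = adj-sym wc

  edge-partition : count (Σ₂ n) (canonical? treeEdge?) + count (Σ₂ n) (canonical? closing?) + count (Σ₂ n) (canonical? crossing?)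
                 ≤ count (Σ₂ n) (canonical? adj?)
  edge-partition = begin
    #T + #L + #X                       ≡⟨ cong (_+ #X) (sym (count-⊎ (Σ₂ n) tree? close? tree-not-closing)) ⟩
    count (Σ₂ n) tree-or-close? + #X   ≡⟨ sym (count-⊎ (Σ₂ n) tree-or-close? cross? crossing-disjoint) ⟩
    count (Σ₂ n) classified?           ≤⟨ count-mono (Σ₂ n) classified? (canonical? adj?) edge ⟩
    count (Σ₂ n) (canonical? adj?)     ∎
    where
    open ≤-Reasoning
    tree? : Decidable (Canonical TreeEdge)
    tree? = canonical? treeEdge?
    close? : Decidable (Canonical Closing)
    close? = canonical? closing?
    cross? : Decidable (Canonical Crossing)
    cross? = canonical? crossing?
    tree-or-close? : Decidable (λ e → Canonical TreeEdge e ⊎ Canonical Closing e)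
    tree-or-close? e = tree? e ⊎-dec close? e
    classified? : Decidable (λ e → (Canonical TreeEdge e ⊎ Canonical Closing e) ⊎ Canonical Crossing e)
    classified? e = tree-or-close? e ⊎-dec cross? e
    #T #L #X : ℕ
    #T = count (Σ₂ n) tree?
    #L = count (Σ₂ n) close?
    #X = count (Σ₂ n) cross?
    tree-not-closing : ∀ {e} → Canonical TreeEdge e → Canonical Closing e → ⊥
    tree-not-closing (tree , _) (closing , _) = closing-not-tree closing tree
    crossing-disjoint : ∀ {e} → Canonical TreeEdge e ⊎ Canonical Closing e → Canonical Crossing e → ⊥
    crossing-disjoint (inj₁ (tree , _))    ((_ , ¬tree , _) , _)    = ¬tree tree
    crossing-disjoint (inj₂ (closing , _)) ((_ , _ , ¬closing) , _) = ¬closing closing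
    edge : ∀ {e} → (Canonical TreeEdge e ⊎ Canonical Closing e) ⊎ Canonical Crossing e → Canonical (Adj face) e
    edge (inj₁ (inj₁ (tree , <)))    = treeEdge-adj tree , <
    edge (inj₁ (inj₂ (closing , <))) = closing-adj closing , <
    edge (inj₂ ((ab , _) , <))       = ab , <

  closing-count : 1 ≤ count (Σ₂ n) (canonical? closing?)
  closing-count = count-≥1 (Σ₂ n) (canonical? closing?)
    (unordered-canonical {R = Closing} closing-sym {w} {c} (adj-irrefl wc) (inj₁ (refl , refl)))

  reach-incomplete : ∀ {K} → ¬ (∀ a b → Adj face a b → Reach K a b)
  reach-incomplete reached =
    euler-violated euler-canonical vertex-count (face-count reached) edge-partition closing-count
    where
    euler-violated : ∀ {V F E T L X} → V + F ≡ 2 + E → V ≤ 1 + T → F ≤ 1 + X → T + L + X ≤ E → 1 ≤ L → ⊥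
    euler-violated {V} {F} {E} {T} {L} {X} euler V≤ F≤ partition L≥1 = <-irrefl euler (begin-strict
      V + F           ≤⟨ +-mono-≤ V≤ F≤ ⟩
      1 + T + (1 + X) ≡⟨ cong suc (+-suc T X) ⟩
      2 + (T + X)     <⟨ s≤s (s≤s T+X<T+L+X) ⟩
      2 + (T + L + X) ≤⟨ s≤s (s≤s partition) ⟩
      2 + E           ∎)
      where
      open ≤-Reasoning
      T+X<T+L+X : T + X < T + L + X
      T+X<T+L+X = begin-strict
        T + X       <⟨ ≤-reflexive (sym (+-suc T X)) ⟩
        T + (1 + X) ≤⟨ +-monoʳ-≤ T (+-monoˡ-≤ X L≥1) ⟩
        T + (L + X) ≡⟨ sym (+-assoc T L X) ⟩
        T + L + X   ∎

  separates-vw : ¬ ¬ Separates v w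
  separates-vw ¬sep = reach-bound (¬separates-vw⇒all-reached ¬sep) (λ (_ , reached) → reach-incomplete reached)

  common-neighbour-on-triangle : ∀ {x} → Adj face p x → Adj face x q → Among v w c x
  common-neighbour-on-triangle {x} px xq with among? x
  ... | yes x-on  = x-on
  ... | no  x-off = ⊥-elim (separates-vw (common-neighbour-off-triangle⇒¬separates-vw x-off px xq))

-- Blocked edges

module EdgeIncidence {n : ℕ} (face : FaceRel n) where

  module _ {t₁ t₂ t₃ : Fin n} where
    side₁₂ : SideOf face t₁ t₂ t₃ t₁ t₂
    side₁₂ = inj₁ (refl , refl)
    side₂₁ : SideOf face t₁ t₂ t₃ t₂ t₁
    side₂₁ = inj₂ (inj₁ (refl , refl))
    side₂₃ : SideOf face t₁ t₂ t₃ t₂ t₃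
    side₂₃ = inj₂ (inj₂ (inj₁ (refl , refl)))
    side₃₂ : SideOf face t₁ t₂ t₃ t₃ t₂
    side₃₂ = inj₂ (inj₂ (inj₂ (inj₁ (refl , refl))))
    side₃₁ : SideOf face t₁ t₂ t₃ t₃ t₁
    side₃₁ = inj₂ (inj₂ (inj₂ (inj₂ (inj₁ (refl , refl)))))
    side₁₃ : SideOf face t₁ t₂ t₃ t₁ t₃
    side₁₃ = inj₂ (inj₂ (inj₂ (inj₂ (inj₂ (refl , refl)))))

  sideOf-swap : ∀ {t₁ t₂ t₃ a b} → SideOf face t₁ t₂ t₃ a b → SideOf face t₁ t₂ t₃ b a
  sideOf-swap (inj₁ (refl , refl))                               = side₂₁
  sideOf-swap (inj₂ (inj₁ (refl , refl)))                        = side₁₂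
  sideOf-swap (inj₂ (inj₂ (inj₁ (refl , refl))))                 = side₃₂
  sideOf-swap (inj₂ (inj₂ (inj₂ (inj₁ (refl , refl)))))          = side₂₃
  sideOf-swap (inj₂ (inj₂ (inj₂ (inj₂ (inj₁ (refl , refl))))))   = side₁₃
  sideOf-swap (inj₂ (inj₂ (inj₂ (inj₂ (inj₂ (refl , refl))))))   = side₃₁

  sideOf-sameEdge : ∀ {t₁ t₂ t₃ a b a′ b′} → SameEdge face a b a′ b′ →
    SideOf face t₁ t₂ t₃ a′ b′ → SideOf face t₁ t₂ t₃ a b
  sideOf-sameEdge (inj₁ (refl , refl)) = id
  sideOf-sameEdge (inj₂ (refl , refl)) = sideOf-swap

  consecutive-sameEdgeˡ : ∀ {x y x′ y′ a b} → SameEdge face x y x′ y′ →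
    Consecutive face x′ y′ a b → Consecutive face x y a b
  consecutive-sameEdgeˡ e (t₁ , t₂ , t₃ , f , s , s′) = t₁ , t₂ , t₃ , f , sideOf-sameEdge e s , s′

  consecutive-sameEdgeʳ : ∀ {x y a b a′ b′} → SameEdge face a b a′ b′ →
    Consecutive face x y a′ b′ → Consecutive face x y a b
  consecutive-sameEdgeʳ e (t₁ , t₂ , t₃ , f , s , s′) = t₁ , t₂ , t₃ , f , s , sideOf-sameEdge e s′

  commonTriangle-sameEdge : ∀ {v w x y x′ y′} → SameEdge face x y x′ y′ →
    CommonTriangle face v w x′ y′ → CommonTriangle face v w x y
  commonTriangle-sameEdge e (t₁ , t₂ , t₃ , t , s , s′) = t₁ , t₂ , t₃ , t , s , sideOf-sameEdge e s′

  sameEdge-swap : ∀ {a b} → SameEdge face a b b a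
  sameEdge-swap = inj₂ (refl , refl)

  sameEdge-swapʳ : ∀ {a b c d} → SameEdge face a b c d → SameEdge face a b d c
  sameEdge-swapʳ (inj₁ (a≡c , b≡d)) = inj₂ (a≡c , b≡d)
  sameEdge-swapʳ (inj₂ (a≡d , b≡c)) = inj₁ (a≡d , b≡c)

  seenBy-swap : ∀ {a b s t} → SeenBy face a b s t → SeenBy face a b t s
  seenBy-swap (inj₁ fs) = inj₂ fs
  seenBy-swap (inj₂ fs) = inj₁ fs

  other-edge-of-triangle : ∀ {v w c x y} → Among v w c x → Among v w c y → x ≢ y → ¬ SameEdge face v w x y →
    SameEdge face x y v c ⊎ SameEdge face x y w c
  other-edge-of-triangle (inj₁ refl)        (inj₁ refl)        x≢y _    = ⊥-elim (x≢y refl)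
  other-edge-of-triangle (inj₁ refl)        (inj₂ (inj₁ refl)) _   ¬vw = ⊥-elim (¬vw (inj₁ (refl , refl)))
  other-edge-of-triangle (inj₁ refl)        (inj₂ (inj₂ refl)) _   _    = inj₁ (inj₁ (refl , refl))
  other-edge-of-triangle (inj₂ (inj₁ refl)) (inj₁ refl)        _   ¬vw = ⊥-elim (¬vw (inj₂ (refl , refl)))
  other-edge-of-triangle (inj₂ (inj₁ refl)) (inj₂ (inj₁ refl)) x≢y _    = ⊥-elim (x≢y refl)
  other-edge-of-triangle (inj₂ (inj₁ refl)) (inj₂ (inj₂ refl)) _   _    = inj₂ (inj₁ (refl , refl))
  other-edge-of-triangle (inj₂ (inj₂ refl)) (inj₁ refl)        _   _    = inj₁ (inj₂ (refl , refl))
  other-edge-of-triangle (inj₂ (inj₂ refl)) (inj₂ (inj₁ refl)) _   _    = inj₂ (inj₂ (refl , refl))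
  other-edge-of-triangle (inj₂ (inj₂ refl)) (inj₂ (inj₂ refl)) x≢y _    = ⊥-elim (x≢y refl)

module Blocking {n : ℕ} (face : FaceRel n) (tri : IsPlaneTriangulation face) where
  open Triangulation face tri
  open EdgeIncidence face

  private
    adj₃₁ : ∀ {a b c} → Face face a b c → Adj face c a
    adj₃₁ f = _ , face-rotate (face-rotate f)
    adj₁₃ : ∀ {a b c} → Face face a b c → Adj face a c
    adj₁₃ f = adj-sym (adj₃₁ f)
    adj₂₃ : ∀ {a b c} → Face face a b c → Adj face b c
    adj₂₃ f = _ , face-rotate f
    adj₃₂ : ∀ {a b c} → Face face a b c → Adj face c b
    adj₃₂ f = adj-sym (adj₂₃ f)

  edges-around-flip : ∀ {v w p a b c} → Face face v w p → Face face a b v → Face face b a w → c ≡ a ⊎ c ≡ b →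
    Adj face v c → Adj face w c →
    (Consecutive face v c a b × CommonTriangle face v w v c) × (Consecutive face w c a b × CommonTriangle face v w w c)
  edges-around-flip {v} {w} {p} {a} {b} {c} vwp abv baw c∈ab vc wc = on-triangle c∈ab
    where
    vwc : Triangle face v w c
    vwc = proj₁ (face-distinct vwp) , adj-irrefl wc , adj-irrefl (adj-sym vc) , (_ , vwp) , wc , adj-sym vc
    on-triangle : c ≡ a ⊎ c ≡ b →
      (Consecutive face v c a b × CommonTriangle face v w v c) × (Consecutive face w c a b × CommonTriangle face v w w c)
    on-triangle (inj₁ refl) = ((_ , _ , _ , abv , side₃₁ , side₁₂) , (_ , _ , _ , vwc , side₁₂ , side₁₃))
                            , ((_ , _ , _ , baw , side₃₂ , side₂₁) , (_ , _ , _ , vwc , side₁₂ , side₂₃))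
    on-triangle (inj₂ refl) = ((_ , _ , _ , abv , side₃₂ , side₁₂) , (_ , _ , _ , vwc , side₁₂ , side₁₃))
                            , ((_ , _ , _ , baw , side₃₁ , side₂₁) , (_ , _ , _ , vwc , side₁₂ , side₂₃))

  degree-three-impossible : ∀ {v w x y p q} → Face face v w p → Face face p q v → Face face q p w →
    Face face x y p → Face face y x q → ¬ SameEdge face v w x y → ⊥
  degree-three-impossible vwp pqv qpw xyp yxq ¬vw
    with link-closed (face-rotate (face-rotate vwp)) (face-rotate qpw) pqv (face-rotate (face-rotate xyp))
  ... | x∈ , y∈ with other-edge-of-triangle x∈ y∈ (proj₁ (face-distinct xyp)) ¬vw | face-distinct yxq
  ...   | inj₁ (inj₁ (_ , y≡q)) | _ , _ , q≢y = q≢y (sym y≡q)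
  ...   | inj₁ (inj₂ (x≡q , _)) | _ , x≢q , _ = x≢q x≡q
  ...   | inj₂ (inj₁ (_ , y≡q)) | _ , _ , q≢y = q≢y (sym y≡q)
  ...   | inj₂ (inj₂ (x≡q , _)) | _ , x≢q , _ = x≢q x≡q

  blocked-via-vertex : ∀ {v w x y p q a b c} → Face face v w p → Face face w v q → Face face a b v → Face face b a w →
    Face face x y p → Face face y x q → ¬ SameEdge face v w x y →
    c ≡ a ⊎ c ≡ b → Adj face v c → Adj face w c → c ≢ p → c ≢ q →
    Consecutive face x y a b × CommonTriangle face v w x y
  blocked-via-vertex {v} {w} {x} {y} {a = a} {b} {c} vwp wvq abv baw xyp yxq ¬vw c∈ab vc wc c≢p c≢q =
    via (other-edge-of-triangle (common-neighbour-on-triangle (adj₃₁ xyp) (adj₂₃ yxq))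
                                (common-neighbour-on-triangle (adj₃₂ xyp) (adj₁₃ yxq))
                                (proj₁ (face-distinct xyp)) ¬vw)
    where
    open SeparatingTriangle face tri vwp wvq vc wc c≢p c≢q using (common-neighbour-on-triangle)
    via : SameEdge face x y v c ⊎ SameEdge face x y w c → Consecutive face x y a b × CommonTriangle face v w x y
    via (inj₁ xy~vc) = map (consecutive-sameEdgeˡ xy~vc) (commonTriangle-sameEdge xy~vc)
                           (proj₁ (edges-around-flip vwp abv baw c∈ab vc wc))
    via (inj₂ xy~wc) = map (consecutive-sameEdgeˡ xy~wc) (commonTriangle-sameEdge xy~wc)
                           (proj₂ (edges-around-flip vwp abv baw c∈ab vc wc))

  blocked-oriented : ∀ {v w x y p q a b} → Face face v w p → Face face w v q → Face face a b v → Face face b a w →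
    Face face x y p → Face face y x q → ¬ SameEdge face v w x y → Consecutive face x y a b × CommonTriangle face v w x y
  blocked-oriented {v} {w} {x} {y} {p} {q} {a} {b} vwp wvq abv baw xyp yxq ¬vw
    with a Finₚ.≟ p | a Finₚ.≟ q | b Finₚ.≟ p | b Finₚ.≟ q
  ... | no a≢p   | no a≢q   | _        | _        =
    blocked-via-vertex vwp wvq abv baw xyp yxq ¬vw (inj₁ refl) (adj₃₁ abv) (adj₃₂ baw) a≢p a≢q
  ... | _        | _        | no b≢p   | no b≢q   =
    blocked-via-vertex vwp wvq abv baw xyp yxq ¬vw (inj₂ refl) (adj₃₂ abv) (adj₃₁ baw) b≢p b≢q
  ... | yes refl | _        | yes refl | _        = ⊥-elim (proj₁ (face-distinct abv) refl)
  ... | _        | yes refl | _        | yes refl = ⊥-elim (proj₁ (face-distinct abv) refl)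
  ... | yes refl | _        | _        | yes refl = ⊥-elim (degree-three-impossible vwp abv baw xyp yxq ¬vw)
  ... | _        | yes refl | yes refl | _        =
    ⊥-elim (proj₂ (proj₂ (face-distinct wvq)) (sym (dart-unique (face-rotate (face-rotate vwp)) (face-rotate abv))))

  blocked-seen-xy : ∀ {v w x y p q a b} → Face face v w p → Face face w v q → Face face a b v → Face face b a w →
    SeenBy face x y p q → ¬ SameEdge face v w x y → Consecutive face x y a b × CommonTriangle face v w x y
  blocked-seen-xy vwp wvq abv baw (inj₁ (xyp , yxq)) ¬vw = blocked-oriented vwp wvq abv baw xyp yxq ¬vw
  blocked-seen-xy vwp wvq abv baw (inj₂ (xyq , yxp)) ¬vw =
    map (consecutive-sameEdgeˡ sameEdge-swap) (commonTriangle-sameEdge sameEdge-swap)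
        (blocked-oriented vwp wvq abv baw yxp xyq (¬vw ∘ sameEdge-swapʳ))

  blocked-seen : ∀ {v w x y p q a b} → Face face v w p → Face face w v q → SeenBy face a b v w →
    SeenBy face x y p q → ¬ SameEdge face v w x y → Consecutive face x y a b × CommonTriangle face v w x y
  blocked-seen vwp wvq (inj₁ (abv , baw)) seen-xy ¬vw = blocked-seen-xy vwp wvq abv baw seen-xy ¬vw
  blocked-seen vwp wvq (inj₂ (abw , bav)) seen-xy ¬vw =
    map (consecutive-sameEdgeʳ sameEdge-swap) id (blocked-seen-xy vwp wvq bav abw seen-xy ¬vw)

mainTheorem17 : {n : ℕ} (face : FaceRel n) → IsPlaneTriangulation face →
    (v w x y p q a b : Fin n) →
    BadPair face v w x y p q →
    BlockedBy face a b v w →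
    Consecutive face x y a b × CommonTriangle face v w x y
mainTheorem17 face tri v w x y p q a b (_ , _ , ¬vw , seen-vw , seen-xy) (_ , seen-ab , _) = oriented seen-vw
  where
  open Blocking face tri
  open EdgeIncidence face using (seenBy-swap)
  oriented : SeenBy face v w p q → Consecutive face x y a b × CommonTriangle face v w x y
  oriented (inj₁ (vwp , wvq)) = blocked-seen vwp wvq seen-ab seen-xy ¬vw
  oriented (inj₂ (vwq , wvp)) = blocked-seen vwq wvp seen-ab (seenBy-swap seen-xy) ¬vw
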